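{- The volume of $P_n(132,312)$ is $(n-1)!$.
   Context: $P_n(132,312)=\operatorname{conv}\{(a_1,\dots,a_n)\in\mathbb{R}^n : a_1\cdots a_n\in\mathfrak{S}_n$ avoids both patterns $132$ and $312\}$. Volume means relative volume, i.e. volume with respect to the lattice $(\operatorname{aff} P)\cap\mathbb{Z}^n$ in the affine span of the polytope. -}

module Defs where

open import Data.Nat as ℕ using (ℕ; zero; suc; _∸_)
open import Data.Nat.Properties using (m^n≢0)

open import Data.Integer as ℤ using (ℤ; +_)
open import Data.Rational as ℚ using (ℚ; 0ℚ; 1ℚ; _/_; _+_; _*_; _-_; ∣_∣; _<_; _≤_)
open import Data.Fin as Fin using (Fin; toℕ)
open import Data.Vec as Vec using (Vec; lookup)
open import Data.Product using (Σ; ∃; ∃-syntax; _×_; _,_)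
open import Relation.Binary.PropositionalEquality using (_≡_)
open import Relation.Nullary using (¬_)
open import Function.Definitions using (Injective)

∑ : ∀ {k} → (Fin k → ℚ) → ℚ
∑ {zero}  f = 0ℚ
∑ {suc k} f = f Fin.zero + ∑ (λ j → f (Fin.suc j))

-- Points of ℚ^n (the rational points suffice: all polytopes here are rational)
Point : ℕ → Set
Point n = Fin n → ℚ

PointSet : ℕ → Set₁
PointSet n = Point n → Set

-- σ ∈ 𝔖_n, written in one-line notation σ(1)…σ(n) (values shifted to Fin n)
IsPerm : ∀ {n} → (Fin n → Fin n) → Set
IsPerm σ = Injective _≡_ _≡_ σ

Contains132 : ∀ {n} → (Fin n → Fin n) → Set
Contains132 {n} σ = Σ (Fin n) λ i → Σ (Fin n) λ j → Σ (Fin n) λ k →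
  (i Fin.< j) × (j Fin.< k) × (σ i Fin.< σ k) × (σ k Fin.< σ j)

Contains312 : ∀ {n} → (Fin n → Fin n) → Set
Contains312 {n} σ = Σ (Fin n) λ i → Σ (Fin n) λ j → Σ (Fin n) λ k →
  (i Fin.< j) × (j Fin.< k) × (σ j Fin.< σ k) × (σ k Fin.< σ i)

permPoint : ∀ {n} → (Fin n → Fin n) → Point n
permPoint σ i = + suc (toℕ (σ i)) / 1

V132-312 : (n : ℕ) → PointSet n
V132-312 n x = Σ (Fin n → Fin n) λ σ →
  IsPerm σ × ¬ Contains132 σ × ¬ Contains312 σ × (∀ i → x i ≡ permPoint σ i)

InConv : ∀ {n} → PointSet n → PointSet n
InConv {n} S x = Σ ℕ λ k → Σ (Fin k → Point n) λ p → Σ (Fin k → ℚ) λ c →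
  (∀ j → S (p j)) × (∀ j → 0ℚ ≤ c j) × (∑ c ≡ 1ℚ) ×
  (∀ i → x i ≡ ∑ (λ j → c j * p j i))

AffIndep : ∀ {n k} → (Fin (suc k) → Point n) → Set
AffIndep {n} {k} p = (c : Fin (suc k) → ℚ) → ∑ c ≡ 0ℚ →
  (∀ i → ∑ (λ j → c j * p j i) ≡ 0ℚ) → ∀ j → c j ≡ 0ℚ

AffDim : ∀ {n} → PointSet n → ℕ → Set
AffDim {n} S d =
  (Σ (Fin (suc d) → Point n) λ p → (∀ j → S (p j)) × AffIndep p) ×
  ((p : Fin (suc (suc d)) → Point n) → (∀ j → S (p j)) → ¬ AffIndep p)

InDilate : ∀ {n} → PointSet n → (t : ℕ) → .{{_ : ℕ.NonZero t}} → Vec ℤ n → Set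
InDilate P t z = P (λ i → lookup z i / t)

LatticeCount : ∀ {n} → PointSet n → (t : ℕ) → .{{_ : ℕ.NonZero t}} → ℕ → Set
LatticeCount {n} P t N = Σ (Fin N → Vec ℤ n) λ f →
  Injective _≡_ _≡_ f × (∀ j → InDilate P t (f j)) ×
  (∀ z → InDilate P t z → ∃[ j ] f j ≡ z)

-- Relative volume (w.r.t. the lattice aff(P) ∩ ℤ^n) of a lattice polytope P
-- of dimension d, defined as lim_{t→∞} #(tP ∩ ℤ^n) / t^d.
RelVolume : ∀ {n} → PointSet n → ℚ → Set
RelVolume P v = Σ ℕ λ d → AffDim P d ×
  (∀ t → ∃[ N ] LatticeCount P (suc t) N) ×
  (∀ (ε : ℚ) → 0ℚ < ε → ∃[ T ] ∀ t N → T ℕ.≤ t →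
     LatticeCount P (suc t) N →
     ∣ (_/_ (+ N) ((suc t) ℕ.^ d) {{m^n≢0 (suc t) d}}) - v ∣ < ε)

P132-312 : (n : ℕ) → PointSet n
P132-312 n = InConv (V132-312 n)

-- Read backwards, a permutation avoids 132 and 312 exactly when each entry is the smallest or the
-- largest of the entries from it onwards.  So the reversed polytope Q_n is obtained from Q_{n-1} by
-- lifting: Q_n = {(1 + (n-1)μ, y + (1-μ)·𝟙) : μ ∈ [0,1], y ∈ Q_{n-1}}.  It lies in the hyperplane
-- Σ x = n(n+1)/2 and contains n affinely independent points, so its dimension is n-1.  In the dilate
-- T·Q_n the first coordinate of a lattice point ranges over the integers of an interval of length
-- (n-1)T, so over (n-1)T or (n-1)T + 1 values, and fixing it leaves a translate of T·Q_{n-1}.  Hence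
-- (n-1)! T^(n-1) ≤ #(T·P_n ∩ ℤ^n) ≤ ∏_{k<n} (kT + 1), and the count divided by T^(n-1) tends to (n-1)!.

module Submission where

open import Defs

open import Level using (0ℓ)
open import Function using (_∘_)
open import Function.Definitions using (Injective)
open import Data.Empty using (⊥-elim)
open import Data.Unit using (⊤; tt)
open import Data.Product using (Σ; ∃; ∃-syntax; _×_; _,_; proj₁; proj₂; map₁; map₂; uncurry)
open import Data.Sum as Sum using (_⊎_; inj₁; inj₂)
open import Relation.Nullary using (¬_; yes; no; ¬?)
open import Relation.Nullary.Decidable using (dec⇒maybe; _×-dec_)
open import Relation.Unary using (Decidable)
open import Relation.Binary.Definitions using (tri<; tri≈; tri>)
open import Relation.Binary.PropositionalEquality

open import Data.Nat as ℕ using (ℕ; zero; suc; z≤n; s≤s; _∸_; _!; _^_)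
import Data.Nat.Properties as ℕP
open import Data.Nat.Coprimality as Coprime using (1-coprimeTo)
import Data.Nat.Tactic.RingSolver as ℕRing
open import Data.Integer as ℤ using (ℤ)
import Data.Integer.Properties as ℤP
open import Data.Integer.DivMod using (_/ℕ_; [n/ℕd]*d≤n; n<s[n/ℕd]*d)
import Data.Integer.Tactic.RingSolver as ℤRing
open import Data.Rational as ℚ
  using (ℚ; 0ℚ; 1ℚ; mkℚ; _/_; _+_; _*_; _-_; -_; _≤_; _<_; ∣_∣; *≤*; *<*)
import Data.Rational.Properties as ℚP
import Data.Rational.Unnormalised as ℚᵘ
import Data.Rational.Unnormalised.Properties as ℚᵘP

open import Data.Fin as Fin using (Fin; zero; suc; splitAt; punchIn; punchOut; opposite; toℕ)
import Data.Fin.Properties as FP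
open import Data.Vec as Vec using (Vec)
open import Data.Vec.Properties using (∷-injectiveʳ; lookup∘tabulate; tabulate∘lookup; tabulate-cong)
open import Data.Vec.Functional using (Vector; _++_; insertAt) renaming (_∷_ to _∷ᶠ_)
open import Data.Vec.Functional.Properties using (insertAt-lookup; insertAt-punchIn)
open import Data.List as List using (List; _∷_; []; length; map; applyUpTo; filter)
open import Data.List.Properties using (length-++; length-map; length-applyUpTo; length-filter; filter-accept)
open import Data.List.Membership.Propositional using (_∈_)
open import Data.List.Membership.Propositional.Properties
  using (∈-map⁺; ∈-map⁻; ∈-++⁺ˡ; ∈-++⁺ʳ; ∈-++⁻; ∈-applyUpTo⁺; ∈-applyUpTo⁻; ∈-filter⁺; ∈-filter⁻; ∈-lookup)
open import Data.List.Relation.Unary.Any as Any using (here; there)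
open import Data.List.Relation.Unary.Any.Properties using (lookup-index)
import Data.List.Relation.Unary.All as All
open import Data.List.Relation.Unary.AllPairs using ([]; _∷_)
open import Data.List.Relation.Unary.Unique.Propositional using (Unique)
import Data.List.Relation.Unary.Unique.Propositional.Properties as Unique

open import Algebra.Bundles using (CommutativeRing)
open import Algebra.Properties.Semiring.Sum (CommutativeRing.semiring ℚP.+-*-commutativeRing)
  using (sum; sum-cong-≗; ∑-distrib-+; ∑-comm; sum-remove; *-distribˡ-sum; sum-replicate-zero)
open import Tactic.RingSolver using (solve-∀; solve)
open import Tactic.RingSolver.Core.AlmostCommutativeRing using (AlmostCommutativeRing; fromCommutativeRing)

ℚ-ring : AlmostCommutativeRing 0ℓ 0ℓ
ℚ-ring = fromCommutativeRing ℚP.+-*-commutativeRing (λ x → dec⇒maybe (0ℚ ℚP.≟ x))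

fromℤ : ℤ → ℚ
fromℤ a = mkℚ a 0 (Coprime.sym (1-coprimeTo _))

fromℕ : ℕ → ℚ
fromℕ n = fromℤ (ℤ.+ n)

/1≡fromℤ : ∀ a → a / 1 ≡ fromℤ a
/1≡fromℤ a = ℚP.↥p/↧p≡p (fromℤ a)

fromℤ-* : ∀ a b → fromℤ (a ℤ.* b) ≡ fromℤ a * fromℤ b
fromℤ-* a b = sym (/1≡fromℤ (a ℤ.* b))

fromℤ-+ : ∀ a b → fromℤ (a ℤ.+ b) ≡ fromℤ a + fromℤ b
fromℤ-+ a b = trans (sym (/1≡fromℤ (a ℤ.+ b)))
  (ℚP./-cong (sym (cong₂ ℤ._+_ (ℤP.*-identityʳ a) (ℤP.*-identityʳ b))) refl)

fromℤ-neg : ∀ a → fromℤ (ℤ.- a) ≡ - fromℤ a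
fromℤ-neg (ℤ.+ zero)  = refl
fromℤ-neg (ℤ.+ suc _) = refl
fromℤ-neg ℤ.-[1+ _ ]  = refl

fromℤ-- : ∀ a b → fromℤ (a ℤ.- b) ≡ fromℤ a - fromℤ b
fromℤ-- a b = trans (fromℤ-+ a (ℤ.- b)) (cong (fromℤ a +_) (fromℤ-neg b))

fromℤ-mono-≤ : ∀ {a b} → a ℤ.≤ b → fromℤ a ≤ fromℤ b
fromℤ-mono-≤ {a} {b} a≤b = *≤* (subst₂ ℤ._≤_ (sym (ℤP.*-identityʳ a)) (sym (ℤP.*-identityʳ b)) a≤b)

fromℤ-cancel-≤ : ∀ {a b} → fromℤ a ≤ fromℤ b → a ℤ.≤ b
fromℤ-cancel-≤ {a} {b} (*≤* a≤b) = subst₂ ℤ._≤_ (ℤP.*-identityʳ a) (ℤP.*-identityʳ b) a≤b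

fromℤ-cancel-< : ∀ {a b} → fromℤ a < fromℤ b → a ℤ.< b
fromℤ-cancel-< {a} {b} (*<* a<b) = subst₂ ℤ._<_ (ℤP.*-identityʳ a) (ℤP.*-identityʳ b) a<b

fromℤ-mono-< : ∀ {a b} → a ℤ.< b → fromℤ a < fromℤ b
fromℤ-mono-< {a} {b} a<b = *<* (subst₂ ℤ._<_ (sym (ℤP.*-identityʳ a)) (sym (ℤP.*-identityʳ b)) a<b)

fromℕ-+ : ∀ m n → fromℕ (m ℕ.+ n) ≡ fromℕ m + fromℕ n
fromℕ-+ m n = fromℤ-+ (ℤ.+ m) (ℤ.+ n)

fromℕ-* : ∀ m n → fromℕ (m ℕ.* n) ≡ fromℕ m * fromℕ n
fromℕ-* m n = trans (cong fromℤ (ℤP.pos-* m n)) (fromℤ-* (ℤ.+ m) (ℤ.+ n))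

fromℕ-suc : ∀ n → fromℕ (suc n) ≡ 1ℚ + fromℕ n
fromℕ-suc n = fromℕ-+ 1 n

fromℕ-mono-≤ : ∀ {m n} → m ℕ.≤ n → fromℕ m ≤ fromℕ n
fromℕ-mono-≤ m≤n = fromℤ-mono-≤ (ℤ.+≤+ m≤n)

fromℕ-nonNeg : ∀ n → 0ℚ ≤ fromℕ n
fromℕ-nonNeg n = fromℕ-mono-≤ z≤n

fromℕ-≢0 : ∀ {n} → n ≢ 0 → fromℕ n ≢ 0ℚ
fromℕ-≢0 n≢0 n≡0 = n≢0 (ℤP.+-injective (cong ℚ.numerator n≡0))

*-cancelˡ-≡ : ∀ {a b c} → a ≢ 0ℚ → a * b ≡ a * c → b ≡ c
*-cancelˡ-≡ {a} {b} {c} a≢0 ab≡ac = begin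
  b              ≡⟨ cancel b ⟨
  a⁻¹ * (a * b)  ≡⟨ cong (a⁻¹ *_) ab≡ac ⟩
  a⁻¹ * (a * c)  ≡⟨ cancel c ⟩
  c              ∎
  where
  open ≡-Reasoning
  instance
    a≢0′ : ℚ.NonZero a
    a≢0′ = ℚ.≢-nonZero a≢0
  a⁻¹ = ℚ.1/ a
  cancel : ∀ x → a⁻¹ * (a * x) ≡ x
  cancel x = trans (sym (ℚP.*-assoc a⁻¹ a x))
    (trans (cong (_* x) (ℚP.*-inverseˡ a)) (ℚP.*-identityˡ x))

*-≢0 : ∀ {a b} → a ≢ 0ℚ → b ≢ 0ℚ → a * b ≢ 0ℚ
*-≢0 {a} a≢0 b≢0 ab≡0 = b≢0 (*-cancelˡ-≡ a≢0 (trans ab≡0 (sym (ℚP.*-zeroʳ a))))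

0≤-⇒≤ : ∀ {a b} → 0ℚ ≤ b - a → a ≤ b
0≤-⇒≤ {a} {b} 0≤b-a = subst₂ _≤_ (ℚP.+-identityˡ a) (b-a+a≡b a b) (ℚP.+-monoˡ-≤ a 0≤b-a)
  where
  b-a+a≡b : ∀ a b → b - a + a ≡ b
  b-a+a≡b = solve-∀ ℚ-ring

≤⇒0≤- : ∀ {a b} → a ≤ b → 0ℚ ≤ b - a
≤⇒0≤- {a} {b} a≤b = subst (_≤ b - a) (ℚP.+-inverseʳ a) (ℚP.+-monoˡ-≤ (- a) a≤b)

0≤1 : 0ℚ ≤ 1ℚ
0≤1 = *≤* (ℤ.+≤+ z≤n)

nonNeg-* : ∀ {a b} → 0ℚ ≤ a → 0ℚ ≤ b → 0ℚ ≤ a * b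
nonNeg-* {a} {b} 0≤a 0≤b = ℚP.nonNegative⁻¹ _
  {{ℚP.nonNeg*nonNeg⇒nonNeg a {{ℚ.nonNegative 0≤a}} b {{ℚ.nonNegative 0≤b}}}}

∑≡sum : ∀ {k} (f : Fin k → ℚ) → ∑ f ≡ sum f
∑≡sum {zero}  f = refl
∑≡sum {suc k} f = cong (f zero +_) (∑≡sum (f ∘ suc))

∑-cong : ∀ {k} {f g : Fin k → ℚ} → (∀ j → f j ≡ g j) → ∑ f ≡ ∑ g
∑-cong {f = f} {g} f≗g = trans (∑≡sum f) (trans (sum-cong-≗ f≗g) (sym (∑≡sum g)))

∑-+ : ∀ {k} (f g : Fin k → ℚ) → ∑ (λ j → f j + g j) ≡ ∑ f + ∑ g
∑-+ f g = trans (∑≡sum (λ j → f j + g j)) (trans (∑-distrib-+ f g) (sym (cong₂ _+_ (∑≡sum f) (∑≡sum g))))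

∑-*ˡ : ∀ {k} a (f : Fin k → ℚ) → ∑ (λ j → a * f j) ≡ a * ∑ f
∑-*ˡ a f = trans (∑≡sum (λ j → a * f j)) (trans (sym (*-distribˡ-sum a f)) (cong (a *_) (sym (∑≡sum f))))

∑-*ʳ : ∀ {k} a (f : Fin k → ℚ) → ∑ (λ j → f j * a) ≡ ∑ f * a
∑-*ʳ a f = trans (∑-cong (λ j → ℚP.*-comm (f j) a)) (trans (∑-*ˡ a f) (ℚP.*-comm a (∑ f)))

∑-0 : ∀ k → ∑ {k} (λ _ → 0ℚ) ≡ 0ℚ
∑-0 k = trans (∑≡sum {k} (λ _ → 0ℚ)) (sum-replicate-zero k)

∑-const : ∀ k a → ∑ {k} (λ _ → a) ≡ fromℕ k * a
∑-const zero    a = sym (ℚP.*-zeroˡ a)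
∑-const (suc k) a = begin
  a + ∑ {k} (λ _ → a)  ≡⟨ cong (a +_) (∑-const k a) ⟩
  a + fromℕ k * a      ≡⟨ cong (_+ fromℕ k * a) (ℚP.*-identityˡ a) ⟨
  1ℚ * a + fromℕ k * a ≡⟨ ℚP.*-distribʳ-+ a 1ℚ (fromℕ k) ⟨
  (1ℚ + fromℕ k) * a   ≡⟨ cong (_* a) (fromℕ-suc k) ⟨
  fromℕ (suc k) * a    ∎
  where open ≡-Reasoning

∑-neg : ∀ {k} (f : Fin k → ℚ) → ∑ (λ j → - f j) ≡ - ∑ f
∑-neg f = trans (∑-cong (λ j → neg≡-1* (f j))) (trans (∑-*ˡ (- 1ℚ) f) (sym (neg≡-1* (∑ f))))
  where
  neg≡-1* : ∀ x → - x ≡ - 1ℚ * x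
  neg≡-1* = solve-∀ ℚ-ring

∑-- : ∀ {k} (f g : Fin k → ℚ) → ∑ (λ j → f j - g j) ≡ ∑ f - ∑ g
∑-- f g = trans (∑-+ f (λ j → - g j)) (cong (∑ f +_) (∑-neg g))

∑-mono-≤ : ∀ {k} {f g : Fin k → ℚ} → (∀ j → f j ≤ g j) → ∑ f ≤ ∑ g
∑-mono-≤ {zero}  f≤g = ℚP.≤-refl
∑-mono-≤ {suc k} f≤g = ℚP.+-mono-≤ (f≤g zero) (∑-mono-≤ (f≤g ∘ suc))

∑-nonNeg : ∀ {k} {f : Fin k → ℚ} → (∀ j → 0ℚ ≤ f j) → 0ℚ ≤ ∑ f
∑-nonNeg {k} {f} 0≤f = subst (_≤ ∑ f) (∑-0 k) (∑-mono-≤ 0≤f)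

∑-swap : ∀ {k l} (f : Fin k → Fin l → ℚ) → ∑ (λ i → ∑ (f i)) ≡ ∑ (λ j → ∑ (λ i → f i j))
∑-swap f = begin
  ∑ (λ i → ∑ (f i))             ≡⟨ trans (∑-cong (λ i → ∑≡sum (f i))) (∑≡sum (λ i → sum (f i))) ⟩
  sum (λ i → sum (f i))         ≡⟨ ∑-comm f ⟩
  sum (λ j → sum (λ i → f i j)) ≡⟨ trans (∑-cong (λ j → ∑≡sum (λ i → f i j))) (∑≡sum (λ j → sum (λ i → f i j))) ⟨
  ∑ (λ j → ∑ (λ i → f i j))    ∎
  where open ≡-Reasoning

∑-pivot : ∀ {k} (f : Fin (suc k) → ℚ) j → ∑ f ≡ f j + ∑ (f ∘ punchIn j)
∑-pivot f j = trans (∑≡sum f) (trans (sum-remove f) (cong (f j +_) (sym (∑≡sum (f ∘ punchIn j)))))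

∑-++ : ∀ {k l} (f : Fin k → ℚ) (g : Fin l → ℚ) → ∑ (f ++ g) ≡ ∑ f + ∑ g
∑-++ {zero}  f g = sym (ℚP.+-identityˡ (∑ g))
∑-++ {suc k} f g = begin
  f zero + ∑ ((f ++ g) ∘ suc)  ≡⟨ cong (f zero +_) (∑-cong (++-suc f g)) ⟩
  f zero + ∑ ((f ∘ suc) ++ g)  ≡⟨ cong (f zero +_) (∑-++ (f ∘ suc) g) ⟩
  f zero + (∑ (f ∘ suc) + ∑ g) ≡⟨ ℚP.+-assoc (f zero) _ _ ⟨
  ∑ f + ∑ g                    ∎
  where
  open ≡-Reasoning
  ++-suc : ∀ {A : Set} {k l} (f : Vector A (suc k)) (g : Vector A l) j →
           (f ++ g) (suc j) ≡ ((f ∘ suc) ++ g) j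
  ++-suc {k = k} f g j with splitAt k j
  ... | inj₁ _ = refl
  ... | inj₂ _ = refl

++-all : ∀ {A : Set} {P : A → Set} {k l} {f : Vector A k} {g : Vector A l} →
         (∀ j → P (f j)) → (∀ j → P (g j)) → ∀ j → P ((f ++ g) j)
++-all {k = k} Pf Pg j with splitAt k j
... | inj₁ j′ = Pf j′
... | inj₂ j′ = Pg j′

++-zipWith : ∀ {A B C : Set} {k l} (_⊙_ : A → B → C)
             (f : Vector A k) (g : Vector A l) (f′ : Vector B k) (g′ : Vector B l) j →
             ((f ++ g) j ⊙ (f′ ++ g′) j) ≡ ((λ i → f i ⊙ f′ i) ++ (λ i → g i ⊙ g′ i)) j
++-zipWith {k = k} _⊙_ f g f′ g′ j with splitAt k j
... | inj₁ _ = refl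
... | inj₂ _ = refl

module _ {n : ℕ} {S : PointSet n} where

  ∈⇒∈conv : ∀ {x} → S x → InConv S x
  ∈⇒∈conv {x} x∈S =
    1 , (λ _ → x) , (λ _ → 1ℚ) , (λ _ → x∈S) , (λ _ → fromℕ-nonNeg 1) , refl , λ i → a≡1a+0 (x i)
    where
    a≡1a+0 : ∀ a → a ≡ 1ℚ * a + 0ℚ
    a≡1a+0 = solve-∀ ℚ-ring

  conv-cong : ∀ {x y} → InConv S x → (∀ i → x i ≡ y i) → InConv S y
  conv-cong (k , p , c , p∈S , 0≤c , ∑c≡1 , x≡) x≗y =
    k , p , c , p∈S , 0≤c , ∑c≡1 , λ i → trans (sym (x≗y i)) (x≡ i)

  conv-mix : ∀ {x y} μ → 0ℚ ≤ μ → μ ≤ 1ℚ → InConv S x → InConv S y →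
             InConv S (λ i → μ * x i + (1ℚ - μ) * y i)
  conv-mix {x} {y} μ 0≤μ μ≤1 (k , p , c , p∈S , 0≤c , ∑c≡1 , x≡) (l , q , d , q∈S , 0≤d , ∑d≡1 , y≡) =
    k ℕ.+ l , p ++ q , w , ++-all {P = S} p∈S q∈S ,
    ++-all {P = 0ℚ ≤_} (λ j → nonNeg-* 0≤μ (0≤c j)) (λ j → nonNeg-* (≤⇒0≤- μ≤1) (0≤d j)) ,
    ∑w≡1 , x≡∑wpq
    where
    open ≡-Reasoning
    w : Fin (k ℕ.+ l) → ℚ
    w = (λ j → μ * c j) ++ (λ j → (1ℚ - μ) * d j)
    weights-sum : ∀ μ → μ * 1ℚ + (1ℚ - μ) * 1ℚ ≡ 1ℚ
    weights-sum = solve-∀ ℚ-ring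
    ∑w≡1 : ∑ w ≡ 1ℚ
    ∑w≡1 = begin
      ∑ w                                           ≡⟨ ∑-++ (λ j → μ * c j) (λ j → (1ℚ - μ) * d j) ⟩
      ∑ (λ j → μ * c j) + ∑ (λ j → (1ℚ - μ) * d j) ≡⟨ cong₂ _+_ (∑-*ˡ μ c) (∑-*ˡ (1ℚ - μ) d) ⟩
      μ * ∑ c + (1ℚ - μ) * ∑ d                      ≡⟨ cong₂ (λ a b → μ * a + (1ℚ - μ) * b) ∑c≡1 ∑d≡1 ⟩
      μ * 1ℚ + (1ℚ - μ) * 1ℚ                        ≡⟨ weights-sum μ ⟩
      1ℚ                                            ∎
    x≡∑wpq : ∀ i → μ * x i + (1ℚ - μ) * y i ≡ ∑ (λ j → w j * (p ++ q) j i)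
    x≡∑wpq i = begin
      μ * x i + (1ℚ - μ) * y i
        ≡⟨ cong₂ (λ a b → μ * a + (1ℚ - μ) * b) (x≡ i) (y≡ i) ⟩
      μ * ∑ (λ j → c j * p j i) + (1ℚ - μ) * ∑ (λ j → d j * q j i)
        ≡⟨ cong₂ _+_ (∑-*ˡ μ (λ j → c j * p j i)) (∑-*ˡ (1ℚ - μ) (λ j → d j * q j i)) ⟨
      ∑ (λ j → μ * (c j * p j i)) + ∑ (λ j → (1ℚ - μ) * (d j * q j i))
        ≡⟨ cong₂ _+_ (∑-cong (λ j → ℚP.*-assoc μ (c j) (p j i)))
                     (∑-cong (λ j → ℚP.*-assoc (1ℚ - μ) (d j) (q j i))) ⟨
      ∑ (λ j → μ * c j * p j i) + ∑ (λ j → (1ℚ - μ) * d j * q j i)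
        ≡⟨ ∑-++ (λ j → μ * c j * p j i) (λ j → (1ℚ - μ) * d j * q j i) ⟨
      ∑ ((λ j → μ * c j * p j i) ++ (λ j → (1ℚ - μ) * d j * q j i))
        ≡⟨ ∑-cong (++-zipWith (λ a (r : Point n) → a * r i) (λ j → μ * c j) (λ j → (1ℚ - μ) * d j) p q) ⟨
      ∑ (λ j → w j * (p ++ q) j i) ∎

AffineMap : ∀ {n m} → (Point n → Point m) → Set
AffineMap {n} g = ∀ {k} x (p : Fin k → Point n) (c : Fin k → ℚ) → ∑ c ≡ 1ℚ →
  (∀ i → x i ≡ ∑ (λ j → c j * p j i)) → ∀ i → g x i ≡ ∑ (λ j → c j * g (p j) i)

conv-map : ∀ {n m} {S : PointSet n} {S′ : PointSet m} (g : Point n → Point m) → AffineMap g →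
           (∀ {y} → S y → S′ (g y)) → ∀ {x} → InConv S x → InConv S′ (g x)
conv-map g g-affine g[S]⊆S′ (k , p , c , p∈S , 0≤c , ∑c≡1 , x≡) =
  k , g ∘ p , c , g[S]⊆S′ ∘ p∈S , 0≤c , ∑c≡1 , g-affine _ p c ∑c≡1 x≡

reindex-affine : ∀ {n} (π : Fin n → Fin n) → AffineMap (_∘ π)
reindex-affine π x p c _ x≡ i = x≡ (π i)

-- Reversed permutations avoiding 132 and 312

Straddled : ∀ {m} → (Fin m → Fin m) → Set
Straddled {m} ρ = Σ (Fin m) λ a → Σ (Fin m) λ b → Σ (Fin m) λ c →
  (a Fin.< b) × (a Fin.< c) × (ρ b Fin.< ρ a) × (ρ a Fin.< ρ c)

opposite-< : ∀ {n} {i j : Fin n} → i Fin.< j → opposite j Fin.< opposite i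
opposite-< {n} {i} {j} i<j = subst₂ ℕ._<_ (sym (FP.opposite-prop j)) (sym (FP.opposite-prop i))
  (ℕP.∸-monoʳ-< (s≤s i<j) (FP.toℕ<n j))

opposite-injective : ∀ {n} → Injective _≡_ _≡_ (opposite {n})
opposite-injective {x = i} {j} e =
  trans (sym (FP.opposite-involutive i)) (trans (cong opposite e) (FP.opposite-involutive j))

reverse-isPerm : ∀ {n} {σ : Fin n → Fin n} → IsPerm σ → IsPerm (σ ∘ opposite)
reverse-isPerm σ-injective = opposite-injective ∘ σ-injective

straddled-reverse : ∀ {n} {σ : Fin n → Fin n} → Straddled (σ ∘ opposite) → Contains132 σ ⊎ Contains312 σ
straddled-reverse {σ = σ} (a , b , c , a<b , a<c , σb<σa , σa<σc) with FP.<-cmp (opposite b) (opposite c)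
... | tri< b′<c′ _ _ = inj₁ (opposite b , opposite c , opposite a , b′<c′ , opposite-< a<c , σb<σa , σa<σc)
... | tri> _ _ c′<b′ = inj₂ (opposite c , opposite b , opposite a , c′<b′ , opposite-< a<b , σb<σa , σa<σc)
... | tri≈ _ b′≡c′ _ =
  ⊥-elim (FP.<-asym σb<σa (subst (λ k → σ (opposite a) Fin.< σ k) (sym b′≡c′) σa<σc))

contains132-reverse : ∀ {n} {ρ : Fin n → Fin n} → Contains132 (ρ ∘ opposite) → Straddled ρ
contains132-reverse (i , j , k , i<j , j<k , ρi<ρk , ρk<ρj) =
  opposite k , opposite i , opposite j , opposite-< (FP.<-trans i<j j<k) , opposite-< j<k , ρi<ρk , ρk<ρj

contains312-reverse : ∀ {n} {ρ : Fin n → Fin n} → Contains312 (ρ ∘ opposite) → Straddled ρ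
contains312-reverse (i , j , k , i<j , j<k , ρj<ρk , ρk<ρi) =
  opposite k , opposite j , opposite i , opposite-< j<k , opposite-< (FP.<-trans i<j j<k) , ρj<ρk , ρk<ρi

Vertex : (m : ℕ) → PointSet m
Vertex m y = Σ (Fin m → Fin m) λ ρ → IsPerm ρ × ¬ Straddled ρ × (∀ i → y i ≡ permPoint ρ i)

-- P_m(132,312) with its coordinates listed in reverse order.
Q : (m : ℕ) → PointSet m
Q m = InConv (Vertex m)

V⇒Vertex : ∀ {n y} → V132-312 n y → Vertex n (y ∘ opposite)
V⇒Vertex (σ , σ-perm , ¬132 , ¬312 , y≡) =
  σ ∘ opposite , reverse-isPerm σ-perm , Sum.[ ¬132 , ¬312 ] ∘ straddled-reverse , y≡ ∘ opposite

Vertex⇒V : ∀ {n y} → Vertex n y → V132-312 n (y ∘ opposite)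
Vertex⇒V (ρ , ρ-perm , ¬straddled , y≡) =
  ρ ∘ opposite , reverse-isPerm ρ-perm , ¬straddled ∘ contains132-reverse ,
  ¬straddled ∘ contains312-reverse , y≡ ∘ opposite

P⇒Q : ∀ {n x} → P132-312 n x → Q n (x ∘ opposite)
P⇒Q {n} = conv-map {S = V132-312 n} {S′ = Vertex n} (_∘ opposite) (reindex-affine opposite) V⇒Vertex

Q⇒P : ∀ {n y} → Q n y → P132-312 n (y ∘ opposite)
Q⇒P {n} = conv-map {S = Vertex n} {S′ = V132-312 n} (_∘ opposite) (reindex-affine opposite) Vertex⇒V

prepend : ∀ {n} → Fin (suc n) → (Fin n → Fin n) → Fin (suc n) → Fin (suc n)
prepend p τ zero    = p
prepend p τ (suc i) = punchIn p (τ i)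

Extreme : ∀ {n} → Fin (suc n) → Set
Extreme {n} p = p ≡ zero ⊎ p ≡ Fin.fromℕ n

punchIn-mono-< : ∀ {n} (p : Fin (suc n)) {i j : Fin n} → i Fin.< j → punchIn p i Fin.< punchIn p j
punchIn-mono-< p {i} {j} i<j = FP.≤∧≢⇒< (FP.punchIn-mono-≤ p i j (ℕP.<⇒≤ i<j))
  (FP.<⇒≢ i<j ∘ FP.punchIn-injective p i j)

punchIn-cancel-< : ∀ {n} (p : Fin (suc n)) {i j : Fin n} → punchIn p i Fin.< punchIn p j → i Fin.< j
punchIn-cancel-< p {i} {j} pi<pj = FP.≤∧≢⇒< (FP.punchIn-cancel-≤ p i j (ℕP.<⇒≤ pi<pj))
  (λ i≡j → FP.<-irrefl (cong (punchIn p) i≡j) pi<pj)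

prepend-isPerm : ∀ {n} p {τ : Fin n → Fin n} → IsPerm τ → IsPerm (prepend p τ)
prepend-isPerm p τ-inj {zero}  {zero}  _ = refl
prepend-isPerm p τ-inj {zero}  {suc j} e = ⊥-elim (FP.punchInᵢ≢i p _ (sym e))
prepend-isPerm p τ-inj {suc i} {zero}  e = ⊥-elim (FP.punchInᵢ≢i p _ e)
prepend-isPerm p τ-inj {suc i} {suc j} e = cong suc (τ-inj (FP.punchIn-injective p _ _ e))

prepend-¬straddled : ∀ {n} {p} {τ : Fin n → Fin n} → Extreme p → ¬ Straddled τ → ¬ Straddled (prepend p τ)
prepend-¬straddled (inj₁ refl) _ (zero , suc _ , suc _ , _ , _ , τb<p , _) = ℕP.n≮0 τb<p
prepend-¬straddled (inj₂ refl) _ (zero , suc _ , suc _ , _ , _ , _ , p<τc) = ℕP.<⇒≱ p<τc (FP.≤fromℕ _)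
prepend-¬straddled {p = p} _ ¬straddled (suc a , suc b , suc c , s≤s a<b , s≤s a<c , τb<τa , τa<τc) =
  ¬straddled (a , b , c , a<b , a<c , punchIn-cancel-< p τb<τa , punchIn-cancel-< p τa<τc)

isPerm⇒surjective : ∀ {m} {ρ : Fin m → Fin m} → IsPerm ρ → ∀ y → ∃ λ x → ρ x ≡ y
isPerm⇒surjective {zero}      _     ()
isPerm⇒surjective {suc m} {ρ} ρ-inj y with FP.any? (λ x → ρ x FP.≟ y)
... | yes hit = hit
... | no miss = ⊥-elim (FP.<⇒notInjective {f = squeeze} (ℕP.n<1+n m) squeeze-injective)
  where
  y≢ρ : ∀ x → y ≢ ρ x
  y≢ρ x y≡ρx = miss (x , sym y≡ρx)
  squeeze : Fin (suc m) → Fin m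
  squeeze x = punchOut (y≢ρ x)
  squeeze-injective : Injective _≡_ _≡_ squeeze
  squeeze-injective e = ρ-inj (FP.punchOut-injective (y≢ρ _) (y≢ρ _) e)

first-extreme : ∀ {n} {ρ : Fin (suc n) → Fin (suc n)} → IsPerm ρ → ¬ Straddled ρ → Extreme (ρ zero)
first-extreme {n} {ρ} ρ-inj ¬straddled with ρ zero FP.≟ zero | ρ zero FP.≟ Fin.fromℕ n
... | yes ρ₀≡0 | _         = inj₁ ρ₀≡0
... | no _     | yes ρ₀≡n  = inj₂ ρ₀≡n
... | no ρ₀≢0  | no ρ₀≢n   with isPerm⇒surjective ρ-inj zero | isPerm⇒surjective ρ-inj (Fin.fromℕ n)
...   | b , ρb≡0 | c , ρc≡n = ⊥-elim (¬straddled
  (zero , b , c , 0<b , 0<c , subst (Fin._< ρ zero) (sym ρb≡0) 0<ρ₀ , subst (ρ zero Fin.<_) (sym ρc≡n) ρ₀<n))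
  where
  0<ρ₀ : zero {n} Fin.< ρ zero
  0<ρ₀ = FP.≤∧≢⇒< z≤n (ρ₀≢0 ∘ sym)
  ρ₀<n : ρ zero Fin.< Fin.fromℕ n
  ρ₀<n = FP.≤∧≢⇒< (FP.≤fromℕ _) ρ₀≢n
  0<b : zero {n} Fin.< b
  0<b = FP.≤∧≢⇒< z≤n (λ 0≡b → ρ₀≢0 (trans (cong ρ 0≡b) ρb≡0))
  0<c : zero {n} Fin.< c
  0<c = FP.≤∧≢⇒< z≤n (λ 0≡c → ρ₀≢n (trans (cong ρ 0≡c) ρc≡n))

peel : ∀ {n} {ρ : Fin (suc n) → Fin (suc n)} → IsPerm ρ → ¬ Straddled ρ →
       Σ (Fin n → Fin n) λ τ → IsPerm τ × ¬ Straddled τ × (∀ i → ρ i ≡ prepend (ρ zero) τ i)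
peel {n} {ρ} ρ-inj ¬straddled = τ , τ-inj , τ-¬straddled , ρ≗
  where
  ρ₀≢ρ : ∀ i → ρ zero ≢ ρ (suc i)
  ρ₀≢ρ i e with ρ-inj e
  ... | ()
  τ : Fin n → Fin n
  τ i = punchOut (ρ₀≢ρ i)
  ρ≗ : ∀ i → ρ i ≡ prepend (ρ zero) τ i
  ρ≗ zero    = refl
  ρ≗ (suc i) = sym (FP.punchIn-punchOut (ρ₀≢ρ i))
  τ-inj : IsPerm τ
  τ-inj e = FP.suc-injective (ρ-inj (FP.punchOut-injective (ρ₀≢ρ _) (ρ₀≢ρ _) e))
  τ-¬straddled : ¬ Straddled τ
  τ-¬straddled (a , b , c , a<b , a<c , τb<τa , τa<τc) = ¬straddled
    (suc a , suc b , suc c , s≤s a<b , s≤s a<c ,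
     subst₂ Fin._<_ (sym (ρ≗ (suc b))) (sym (ρ≗ (suc a))) (punchIn-mono-< (ρ zero) τb<τa) ,
     subst₂ Fin._<_ (sym (ρ≗ (suc a))) (sym (ρ≗ (suc c))) (punchIn-mono-< (ρ zero) τa<τc))

-- Q_{n+1} as a lift of Q_n

lift : ∀ {n} → ℚ → Point n → Point (suc n)
lift {n} μ y zero    = 1ℚ + fromℕ n * μ
lift     μ y (suc i) = y i + (1ℚ - μ)

lift-cong : ∀ {n} {μ ν} {y y′ : Point n} → μ ≡ ν → (∀ i → y i ≡ y′ i) → ∀ i → lift μ y i ≡ lift ν y′ i
lift-cong refl y≗y′ zero    = refl
lift-cong refl y≗y′ (suc i) = cong (_+ _) (y≗y′ i)

record Lifted {n} (S : PointSet n) (x : Point (suc n)) : Set where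
  constructor lifted
  field
    μ       : ℚ
    0≤μ     : 0ℚ ≤ μ
    μ≤1     : μ ≤ 1ℚ
    base    : Point n
    base∈S  : S base
    x≗lift  : ∀ i → x i ≡ lift μ base i

permPoint≡fromℕ : ∀ {n} (ρ : Fin n → Fin n) i → permPoint ρ i ≡ fromℕ (suc (toℕ (ρ i)))
permPoint≡fromℕ ρ i = /1≡fromℤ (ℤ.+ suc (toℕ (ρ i)))

toℕ-punchIn-fromℕ : ∀ {n} (j : Fin n) → toℕ (punchIn (Fin.fromℕ n) j) ≡ toℕ j
toℕ-punchIn-fromℕ {suc n} zero    = refl
toℕ-punchIn-fromℕ {suc n} (suc j) = cong suc (toℕ-punchIn-fromℕ j)

permPoint-prepend-min : ∀ {n} (τ : Fin n → Fin n) i → permPoint (prepend zero τ) i ≡ lift 0ℚ (permPoint τ) i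
permPoint-prepend-min {n} τ zero = sym (1+N*0≡1 (fromℕ n))
  where
  1+N*0≡1 : ∀ N → 1ℚ + N * 0ℚ ≡ 1ℚ
  1+N*0≡1 = solve-∀ ℚ-ring
permPoint-prepend-min τ (suc i) = begin
  permPoint (prepend zero τ) (suc i)  ≡⟨ permPoint≡fromℕ (prepend zero τ) (suc i) ⟩
  fromℕ (suc (suc (toℕ (τ i))))       ≡⟨ fromℕ-suc (suc (toℕ (τ i))) ⟩
  1ℚ + fromℕ (suc (toℕ (τ i)))        ≡⟨ 1+a≡a+[1-0] (fromℕ (suc (toℕ (τ i)))) ⟩
  fromℕ (suc (toℕ (τ i))) + (1ℚ - 0ℚ) ≡⟨ cong (_+ (1ℚ - 0ℚ)) (permPoint≡fromℕ τ i) ⟨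
  permPoint τ i + (1ℚ - 0ℚ)           ∎
  where
  open ≡-Reasoning
  1+a≡a+[1-0] : ∀ a → 1ℚ + a ≡ a + (1ℚ - 0ℚ)
  1+a≡a+[1-0] = solve-∀ ℚ-ring

permPoint-prepend-max : ∀ {n} (τ : Fin n → Fin n) i →
                        permPoint (prepend (Fin.fromℕ n) τ) i ≡ lift 1ℚ (permPoint τ) i
permPoint-prepend-max {n} τ zero = begin
  permPoint (prepend (Fin.fromℕ n) τ) zero ≡⟨ permPoint≡fromℕ (prepend (Fin.fromℕ n) τ) zero ⟩
  fromℕ (suc (toℕ (Fin.fromℕ n)))          ≡⟨ cong (fromℕ ∘ suc) (FP.toℕ-fromℕ n) ⟩
  fromℕ (suc n)                            ≡⟨ fromℕ-suc n ⟩
  1ℚ + fromℕ n                             ≡⟨ cong (1ℚ +_) (ℚP.*-identityʳ (fromℕ n)) ⟨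
  1ℚ + fromℕ n * 1ℚ                        ∎
  where open ≡-Reasoning
permPoint-prepend-max {n} τ (suc i) = begin
  permPoint (prepend (Fin.fromℕ n) τ) (suc i) ≡⟨ permPoint≡fromℕ (prepend (Fin.fromℕ n) τ) (suc i) ⟩
  fromℕ (suc (toℕ (punchIn (Fin.fromℕ n) (τ i)))) ≡⟨ cong (fromℕ ∘ suc) (toℕ-punchIn-fromℕ (τ i)) ⟩
  fromℕ (suc (toℕ (τ i)))                     ≡⟨ permPoint≡fromℕ τ i ⟨
  permPoint τ i                               ≡⟨ a≡a+[1-1] (permPoint τ i) ⟩
  permPoint τ i + (1ℚ - 1ℚ)                   ∎
  where
  open ≡-Reasoning
  a≡a+[1-1] : ∀ a → a ≡ a + (1ℚ - 1ℚ)
  a≡a+[1-1] = solve-∀ ℚ-ring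

vertex-lift₀ : ∀ {n y} → Vertex n y → Vertex (suc n) (lift 0ℚ y)
vertex-lift₀ (τ , τ-perm , ¬straddled , y≡) =
  prepend zero τ , prepend-isPerm zero τ-perm , prepend-¬straddled (inj₁ refl) ¬straddled ,
  λ i → trans (lift-cong refl y≡ i) (sym (permPoint-prepend-min τ i))

vertex-lift₁ : ∀ {n y} → Vertex n y → Vertex (suc n) (lift 1ℚ y)
vertex-lift₁ {n} (τ , τ-perm , ¬straddled , y≡) =
  prepend (Fin.fromℕ n) τ , prepend-isPerm (Fin.fromℕ n) τ-perm , prepend-¬straddled (inj₂ refl) ¬straddled ,
  λ i → trans (lift-cong refl y≡ i) (sym (permPoint-prepend-max τ i))

vertex-peel : ∀ {n x} → Vertex (suc n) x → Lifted (Vertex n) x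
vertex-peel {n} {x} (ρ , ρ-perm , ¬straddled , x≡) with peel ρ-perm ¬straddled
... | τ , τ-perm , τ-¬straddled , ρ≗ = from-extreme (first-extreme ρ-perm ¬straddled)
  where
  τ∈V : Vertex n (permPoint τ)
  τ∈V = τ , τ-perm , τ-¬straddled , λ _ → refl
  x≡prepend : ∀ {p} → ρ zero ≡ p → ∀ i → x i ≡ permPoint (prepend p τ) i
  x≡prepend refl i = trans (x≡ i) (cong (λ k → ℤ.+ suc (toℕ k) / 1) (ρ≗ i))
  from-extreme : Extreme (ρ zero) → Lifted (Vertex n) x
  from-extreme (inj₁ ρ₀≡0) = lifted 0ℚ ℚP.≤-refl 0≤1 (permPoint τ) τ∈V
    (λ i → trans (x≡prepend ρ₀≡0 i) (permPoint-prepend-min τ i))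
  from-extreme (inj₂ ρ₀≡n) = lifted 1ℚ 0≤1 ℚP.≤-refl (permPoint τ) τ∈V
    (λ i → trans (x≡prepend ρ₀≡n i) (permPoint-prepend-max τ i))

∑-lift-head : ∀ {n k} (c δ : Fin k → ℚ) (y : Fin k → Point n) →
              ∑ (λ j → c j * lift (δ j) (y j) zero) ≡ ∑ c + fromℕ n * ∑ (λ j → c j * δ j)
∑-lift-head {n} c δ y = begin
  ∑ (λ j → c j * (1ℚ + N * δ j))      ≡⟨ ∑-cong (λ j → expand (c j) N (δ j)) ⟩
  ∑ (λ j → c j + N * (c j * δ j))     ≡⟨ ∑-+ c (λ j → N * (c j * δ j)) ⟩
  ∑ c + ∑ (λ j → N * (c j * δ j))     ≡⟨ cong (∑ c +_) (∑-*ˡ N (λ j → c j * δ j)) ⟩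
  ∑ c + N * ∑ (λ j → c j * δ j)       ∎
  where
  open ≡-Reasoning
  N = fromℕ n
  expand : ∀ c N δ → c * (1ℚ + N * δ) ≡ c + N * (c * δ)
  expand = solve-∀ ℚ-ring

∑-lift-tail : ∀ {n k} (c δ : Fin k → ℚ) (y : Fin k → Point n) i →
              ∑ (λ j → c j * lift (δ j) (y j) (suc i)) ≡ ∑ (λ j → c j * y j i) + (∑ c - ∑ (λ j → c j * δ j))
∑-lift-tail c δ y i = begin
  ∑ (λ j → c j * (y j i + (1ℚ - δ j)))              ≡⟨ ∑-cong (λ j → expand (c j) (y j i) (δ j)) ⟩
  ∑ (λ j → c j * y j i + (c j - c j * δ j))          ≡⟨ ∑-+ (λ j → c j * y j i) (λ j → c j - c j * δ j) ⟩
  ∑ (λ j → c j * y j i) + ∑ (λ j → c j - c j * δ j)  ≡⟨ cong (∑ (λ j → c j * y j i) +_) (∑-- c (λ j → c j * δ j)) ⟩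
  ∑ (λ j → c j * y j i) + (∑ c - ∑ (λ j → c j * δ j)) ∎
  where
  open ≡-Reasoning
  expand : ∀ c y δ → c * (y + (1ℚ - δ)) ≡ c * y + (c - c * δ)
  expand = solve-∀ ℚ-ring

lift-combination : ∀ {n k} (c δ : Fin k → ℚ) (y : Fin k → Point n) → ∑ c ≡ 1ℚ → ∀ i →
  ∑ (λ j → c j * lift (δ j) (y j) i) ≡ lift (∑ (λ j → c j * δ j)) (λ i′ → ∑ (λ j → c j * y j i′)) i
lift-combination {n} c δ y ∑c≡1 zero    =
  trans (∑-lift-head c δ y) (cong (_+ fromℕ n * ∑ (λ j → c j * δ j)) ∑c≡1)
lift-combination c δ y ∑c≡1 (suc i) =
  trans (∑-lift-tail c δ y i) (cong (λ s → ∑ (λ j → c j * y j i) + (s - ∑ (λ j → c j * δ j))) ∑c≡1)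

lift-affine : ∀ {n} μ → AffineMap (lift {n} μ)
lift-affine μ x p c ∑c≡1 x≡ i = begin
  lift μ x i                                                    ≡⟨ lift-cong μ≡∑cμ x≡ i ⟩
  lift (∑ (λ j → c j * μ)) (λ i′ → ∑ (λ j → c j * p j i′)) i   ≡⟨ lift-combination c (λ _ → μ) p ∑c≡1 i ⟨
  ∑ (λ j → c j * lift μ (p j) i)                                ∎
  where
  open ≡-Reasoning
  μ≡∑cμ : μ ≡ ∑ (λ j → c j * μ)
  μ≡∑cμ = trans (sym (ℚP.*-identityˡ μ)) (trans (cong (_* μ) (sym ∑c≡1)) (sym (∑-*ʳ μ c)))

Q-zero : ∀ x → Q 0 x
Q-zero x = ∈⇒∈conv {S = Vertex 0} ((λ ()) , (λ { {()} }) , (λ { (() , _) }) , λ ())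

Q-lift : ∀ {n x} → Lifted (Q n) x → Q (suc n) x
Q-lift {n} {x} (lifted μ 0≤μ μ≤1 y y∈Q x≗) = conv-cong {S = Vertex (suc n)}
  (conv-mix {S = Vertex (suc n)} μ 0≤μ μ≤1 (lift-conv (lift-affine 1ℚ) vertex-lift₁)
                                           (lift-conv (lift-affine 0ℚ) vertex-lift₀))
  (λ i → trans (mix≡lift i) (sym (x≗ i)))
  where
  lift-conv : ∀ {δ} → AffineMap (lift δ) → (∀ {v} → Vertex n v → Vertex (suc n) (lift δ v)) →
              Q (suc n) (lift δ y)
  lift-conv {δ} affine vertex-lift =
    conv-map {S = Vertex n} {S′ = Vertex (suc n)} (lift δ) affine vertex-lift y∈Q
  mix≡lift : ∀ i → μ * lift 1ℚ y i + (1ℚ - μ) * lift 0ℚ y i ≡ lift μ y i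
  mix≡lift zero    = head-mix μ (fromℕ n)
    where
    head-mix : ∀ μ N → μ * (1ℚ + N * 1ℚ) + (1ℚ - μ) * (1ℚ + N * 0ℚ) ≡ 1ℚ + N * μ
    head-mix = solve-∀ ℚ-ring
  mix≡lift (suc i) = tail-mix μ (y i)
    where
    tail-mix : ∀ μ a → μ * (a + (1ℚ - 1ℚ)) + (1ℚ - μ) * (a + (1ℚ - 0ℚ)) ≡ a + (1ℚ - μ)
    tail-mix = solve-∀ ℚ-ring

Q-peel : ∀ {n x} → Q (suc n) x → Lifted (Q n) x
Q-peel (k , p , c , p∈V , 0≤c , ∑c≡1 , x≡) =
  lifted μ 0≤μ μ≤1 y (k , Lifted.base ∘ peeled , c , Lifted.base∈S ∘ peeled , 0≤c , ∑c≡1 , λ _ → refl) x≗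
  where
  peeled = vertex-peel ∘ p∈V
  δ = λ j → Lifted.μ (peeled j)
  μ = ∑ (λ j → c j * δ j)
  y = λ i → ∑ (λ j → c j * Lifted.base (peeled j) i)
  0≤μ : 0ℚ ≤ μ
  0≤μ = ∑-nonNeg (λ j → nonNeg-* (0≤c j) (Lifted.0≤μ (peeled j)))
  μ≤1 : μ ≤ 1ℚ
  μ≤1 = subst (μ ≤_) ∑c≡1 (∑-mono-≤ (λ j → subst (c j * δ j ≤_) (ℚP.*-identityʳ (c j))
          (ℚP.*-monoˡ-≤-nonNeg (c j) {{ℚ.nonNegative (0≤c j)}} (Lifted.μ≤1 (peeled j)))))
  x≗ : ∀ i → _ ≡ lift μ y i
  x≗ i = trans (x≡ i) (trans (∑-cong (λ j → cong (c j *_) (Lifted.x≗lift (peeled j) i)))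
                                 (lift-combination c δ (Lifted.base ∘ peeled) ∑c≡1 i))

-- Affine dimension

∑-lift : ∀ {n} μ (y : Point n) → ∑ (lift μ y) ≡ 1ℚ + fromℕ n + ∑ y
∑-lift {n} μ y = begin
  (1ℚ + fromℕ n * μ) + ∑ (λ i → y i + (1ℚ - μ))  ≡⟨ cong ((1ℚ + fromℕ n * μ) +_) (∑-+ y (λ _ → 1ℚ - μ)) ⟩
  (1ℚ + fromℕ n * μ) + (∑ y + ∑ {n} (λ _ → 1ℚ - μ)) ≡⟨ cong (λ s → (1ℚ + fromℕ n * μ) + (∑ y + s)) (∑-const n (1ℚ - μ)) ⟩
  (1ℚ + fromℕ n * μ) + (∑ y + fromℕ n * (1ℚ - μ)) ≡⟨ regroup (fromℕ n) μ (∑ y) ⟩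
  1ℚ + fromℕ n + ∑ y                              ∎
  where
  open ≡-Reasoning
  regroup : ∀ N μ s → (1ℚ + N * μ) + (s + N * (1ℚ - μ)) ≡ 1ℚ + N + s
  regroup = solve-∀ ℚ-ring

Q-sums-equal : ∀ {m x x′} → Q m x → Q m x′ → ∑ x ≡ ∑ x′
Q-sums-equal {zero}           _   _    = refl
Q-sums-equal {suc n} {x} {x′} x∈Q x′∈Q with Q-peel x∈Q | Q-peel x′∈Q
... | lifted μ _ _ y y∈Q x≗ | lifted μ′ _ _ y′ y′∈Q x′≗ = begin
  ∑ x                  ≡⟨ ∑-cong x≗ ⟩
  ∑ (lift μ y)         ≡⟨ ∑-lift μ y ⟩
  1ℚ + fromℕ n + ∑ y   ≡⟨ cong (1ℚ + fromℕ n +_) (Q-sums-equal y∈Q y′∈Q) ⟩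
  1ℚ + fromℕ n + ∑ y′  ≡⟨ ∑-lift μ′ y′ ⟨
  ∑ (lift μ′ y′)       ≡⟨ ∑-cong x′≗ ⟨
  ∑ x′                 ∎
  where open ≡-Reasoning

LinearlyDependent : ∀ {k m} → (Fin k → Fin m → ℚ) → Set
LinearlyDependent {k} v = Σ (Fin k → ℚ) λ c → (∃ λ j → c j ≢ 0ℚ) × (∀ i → ∑ (λ j → c j * v j i) ≡ 0ℚ)

Pivot : ∀ {k m} → (Fin (suc k) → Fin (suc m) → ℚ) → Set
Pivot {k} v = Σ (Fin (suc k)) λ j₀ → Σ (Fin k → ℚ) λ α → ∀ j → v (punchIn j₀ j) zero ≡ α j * v j₀ zero

pivot : ∀ {k m} (v : Fin (suc k) → Fin (suc m) → ℚ) → Pivot v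
pivot v with FP.any? (λ j → ¬? (v j zero ℚP.≟ 0ℚ))
... | yes (j₀ , v₀≢0) = j₀ , (λ j → v (punchIn j₀ j) zero * a⁻¹) , λ j → sym (divided j)
  where
  instance
    a≢0 : ℚ.NonZero (v j₀ zero)
    a≢0 = ℚ.≢-nonZero v₀≢0
  a⁻¹ = ℚ.1/ (v j₀ zero)
  divided : ∀ j → v (punchIn j₀ j) zero * a⁻¹ * v j₀ zero ≡ v (punchIn j₀ j) zero
  divided j = trans (ℚP.*-assoc (v (punchIn j₀ j) zero) a⁻¹ (v j₀ zero))
    (trans (cong (v (punchIn j₀ j) zero *_) (ℚP.*-inverseˡ (v j₀ zero))) (ℚP.*-identityʳ _))
... | no no-pivot = zero , (λ _ → 0ℚ) , λ j → trans (vanishes (suc j)) (sym (ℚP.*-zeroˡ (v zero zero)))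
  where
  vanishes : ∀ j → v j zero ≡ 0ℚ
  vanishes j with v j zero ℚP.≟ 0ℚ
  ... | yes v₀≡0 = v₀≡0
  ... | no  v₀≢0 = ⊥-elim (no-pivot (j , v₀≢0))

∑-eliminate : ∀ {k m} (v : Fin (suc k) → Fin m → ℚ) j₀ (d α : Fin k → ℚ) i →
  ∑ (λ j → insertAt d j₀ (- ∑ (λ j → d j * α j)) j * v j i) ≡ ∑ (λ j → d j * (v (punchIn j₀ j) i - α j * v j₀ i))
∑-eliminate v j₀ d α i = begin
  ∑ (λ j → c j * v j i)
    ≡⟨ ∑-pivot (λ j → c j * v j i) j₀ ⟩
  c j₀ * v j₀ i + ∑ (λ j → c (punchIn j₀ j) * v (punchIn j₀ j) i)
    ≡⟨ cong₂ _+_ (cong (_* v j₀ i) (insertAt-lookup d j₀ c₀))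
                 (∑-cong (λ j → cong (_* v (punchIn j₀ j) i) (insertAt-punchIn d j₀ c₀ j))) ⟩
  - ∑ (λ j → d j * α j) * v j₀ i + ∑ (λ j → d j * v (punchIn j₀ j) i)
    ≡⟨ cong (λ s → s * v j₀ i + ∑ (λ j → d j * v (punchIn j₀ j) i)) (∑-neg (λ j → d j * α j)) ⟨
  ∑ (λ j → - (d j * α j)) * v j₀ i + ∑ (λ j → d j * v (punchIn j₀ j) i)
    ≡⟨ cong (_+ ∑ (λ j → d j * v (punchIn j₀ j) i)) (∑-*ʳ (v j₀ i) (λ j → - (d j * α j))) ⟨
  ∑ (λ j → - (d j * α j) * v j₀ i) + ∑ (λ j → d j * v (punchIn j₀ j) i)
    ≡⟨ ∑-+ (λ j → - (d j * α j) * v j₀ i) (λ j → d j * v (punchIn j₀ j) i) ⟨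
  ∑ (λ j → - (d j * α j) * v j₀ i + d j * v (punchIn j₀ j) i)
    ≡⟨ ∑-cong (λ j → rearrange (d j) (α j) (v j₀ i) (v (punchIn j₀ j) i)) ⟩
  ∑ (λ j → d j * (v (punchIn j₀ j) i - α j * v j₀ i)) ∎
  where
  open ≡-Reasoning
  c₀ = - ∑ (λ j → d j * α j)
  c = insertAt d j₀ c₀
  rearrange : ∀ d a x y → - (d * a) * x + d * y ≡ d * (y - a * x)
  rearrange = solve-∀ ℚ-ring

linearlyDependent : ∀ m (v : Fin (suc m) → Fin m → ℚ) → LinearlyDependent v
linearlyDependent zero    v = (λ _ → 1ℚ) , (zero , λ ()) , λ ()
linearlyDependent (suc m) v = eliminate (pivot v)
  where
  eliminate : Pivot v → LinearlyDependent v
  eliminate (j₀ , α , v≡αv) = extend (linearlyDependent m w)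
    where
    w : Fin (suc m) → Fin m → ℚ
    w j i = v (punchIn j₀ j) (suc i) - α j * v j₀ (suc i)
    extend : LinearlyDependent w → LinearlyDependent v
    extend (d , (j₁ , d≢0) , d-kills-w) =
      insertAt d j₀ c₀ , (punchIn j₀ j₁ , d≢0 ∘ trans (sym (insertAt-punchIn d j₀ c₀ j₁))) , kills-v
      where
      c₀ = - ∑ (λ j → d j * α j)
      pivot-vanishes : ∀ j → d j * (v (punchIn j₀ j) zero - α j * v j₀ zero) ≡ 0ℚ
      pivot-vanishes j = trans (cong (λ a → d j * (a - α j * v j₀ zero)) (v≡αv j))
        (trans (cong (d j *_) (ℚP.+-inverseʳ (α j * v j₀ zero))) (ℚP.*-zeroʳ (d j)))
      kills-v : ∀ i → ∑ (λ j → insertAt d j₀ c₀ j * v j i) ≡ 0ℚ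
      kills-v zero    = trans (∑-eliminate v j₀ d α zero) (trans (∑-cong pivot-vanishes) (∑-0 (suc m)))
      kills-v (suc i) = trans (∑-eliminate v j₀ d α (suc i)) (d-kills-w i)

∑-differences : ∀ {k n} (p : Fin (suc k) → Point n) (d : Fin k → ℚ) i →
  ∑ (λ j → ((- ∑ d) ∷ᶠ d) j * p j i) ≡ ∑ (λ j → d j * (p (suc j) i - p zero i))
∑-differences p d i = begin
  - ∑ d * p zero i + ∑ (λ j → d j * p (suc j) i)
    ≡⟨ cong (λ s → s * p zero i + ∑ (λ j → d j * p (suc j) i)) (∑-neg d) ⟨
  ∑ (λ j → - d j) * p zero i + ∑ (λ j → d j * p (suc j) i)
    ≡⟨ cong (_+ ∑ (λ j → d j * p (suc j) i)) (∑-*ʳ (p zero i) (λ j → - d j)) ⟨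
  ∑ (λ j → - d j * p zero i) + ∑ (λ j → d j * p (suc j) i)
    ≡⟨ ∑-+ (λ j → - d j * p zero i) (λ j → d j * p (suc j) i) ⟨
  ∑ (λ j → - d j * p zero i + d j * p (suc j) i)
    ≡⟨ ∑-cong (λ j → factor (d j) (p zero i) (p (suc j) i)) ⟩
  ∑ (λ j → d j * (p (suc j) i - p zero i)) ∎
  where
  open ≡-Reasoning
  factor : ∀ d a b → - d * a + d * b ≡ d * (b - a)
  factor = solve-∀ ℚ-ring

∑-combination≡0 : ∀ {k n} (d : Fin k → ℚ) (u : Fin k → Point n) → (∀ j → ∑ (u j) ≡ 0ℚ) →
                ∑ (λ i → ∑ (λ j → d j * u j i)) ≡ 0ℚ
∑-combination≡0 {k} d u ∑u≡0 = begin
  ∑ (λ i → ∑ (λ j → d j * u j i)) ≡⟨ ∑-swap (λ i j → d j * u j i) ⟩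
  ∑ (λ j → ∑ (λ i → d j * u j i)) ≡⟨ ∑-cong (λ j → ∑-*ˡ (d j) (u j)) ⟩
  ∑ (λ j → d j * ∑ (u j))         ≡⟨ ∑-cong (λ j → trans (cong (d j *_) (∑u≡0 j)) (ℚP.*-zeroʳ (d j))) ⟩
  ∑ {k} (λ _ → 0ℚ)                ≡⟨ ∑-0 k ⟩
  0ℚ                              ∎
  where open ≡-Reasoning

hyperplane-dependent : ∀ {n} (p : Fin (suc (suc n)) → Point (suc n)) →
                       (∀ j → ∑ (p j) ≡ ∑ (p zero)) → ¬ AffIndep p
hyperplane-dependent {n} p ∑p≡ p-indep = absurd (linearlyDependent n (λ j i → u j (suc i)))
  where
  u : Fin (suc n) → Point (suc n)
  u j i = p (suc j) i - p zero i
  ∑u≡0 : ∀ j → ∑ (u j) ≡ 0ℚ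
  ∑u≡0 j = trans (∑-- (p (suc j)) (p zero))
    (trans (cong (_- ∑ (p zero)) (∑p≡ (suc j))) (ℚP.+-inverseʳ (∑ (p zero))))
  absurd : ¬ LinearlyDependent (λ j i → u j (suc i))
  absurd (d , (j₁ , d≢0) , d-kills) = d≢0 (p-indep ((- ∑ d) ∷ᶠ d) (ℚP.+-inverseˡ (∑ d)) c-kills (suc j₁))
    where
    w : Point (suc n)
    w i = ∑ (λ j → d j * u j i)
    c-kills : ∀ i → ∑ (λ j → ((- ∑ d) ∷ᶠ d) j * p j i) ≡ 0ℚ
    c-kills zero    = begin
      ∑ (λ j → ((- ∑ d) ∷ᶠ d) j * p j zero) ≡⟨ ∑-differences p d zero ⟩
      w zero                                 ≡⟨ ℚP.+-identityʳ (w zero) ⟨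
      w zero + 0ℚ                            ≡⟨ cong (w zero +_) (trans (∑-cong d-kills) (∑-0 n)) ⟨
      ∑ w                                    ≡⟨ ∑-combination≡0 d u ∑u≡0 ⟩
      0ℚ                                     ∎
      where open ≡-Reasoning
    c-kills (suc i) = trans (∑-differences p d (suc i)) (d-kills i)

basePoints : ∀ n → Fin (suc n) → Point (suc n)
basePoints zero    _       = lift 1ℚ (λ ())
basePoints (suc n) zero    = lift 0ℚ (basePoints n zero)
basePoints (suc n) (suc j) = lift 1ℚ (basePoints n j)

basePoints-∈Q : ∀ n j → Q (suc n) (basePoints n j)
basePoints-∈Q zero    _       = Q-lift (lifted 1ℚ 0≤1 ℚP.≤-refl _ (Q-zero _) (λ _ → refl))
basePoints-∈Q (suc n) zero    = Q-lift (lifted 0ℚ ℚP.≤-refl 0≤1 _ (basePoints-∈Q n zero) (λ _ → refl))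
basePoints-∈Q (suc n) (suc j) = Q-lift (lifted 1ℚ 0≤1 ℚP.≤-refl _ (basePoints-∈Q n j) (λ _ → refl))

-- The first coordinate forces the weights of the points lifted with μ = 1 to sum to 0; then c₀ = 0
-- and the remaining coordinates are an affine dependence one dimension lower.
basePoints-independent : ∀ n → AffIndep (basePoints n)
basePoints-independent zero    c ∑c≡0 _ zero = trans (sym (ℚP.+-identityʳ (c zero))) ∑c≡0
basePoints-independent (suc n) c ∑c≡0 c-kills = c≡0
  where
  open ≡-Reasoning
  δ : Fin (suc (suc n)) → ℚ
  δ zero    = 0ℚ
  δ (suc _) = 1ℚ
  y : Fin (suc (suc n)) → Point (suc n)
  y zero    = basePoints n zero
  y (suc j) = basePoints n j
  c-kills′ : ∀ i → ∑ (λ j → c j * lift (δ j) (y j) i) ≡ 0ℚ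
  c-kills′ i = trans (∑-cong {f = λ j → c j * lift (δ j) (y j) i} {g = λ j → c j * basePoints (suc n) j i}
                             λ { zero → refl ; (suc j) → refl }) (c-kills i)
  S = ∑ (c ∘ suc)
  ∑cδ≡S : ∑ (λ j → c j * δ j) ≡ S
  ∑cδ≡S = trans (cong (_+ ∑ (λ j → c (suc j) * 1ℚ)) (ℚP.*-zeroʳ (c zero)))
            (trans (ℚP.+-identityˡ _) (∑-cong (λ j → ℚP.*-identityʳ (c (suc j)))))
  S≡0 : S ≡ 0ℚ
  S≡0 = *-cancelˡ-≡ (fromℕ-≢0 {suc n} λ ()) (begin
    fromℕ (suc n) * S                            ≡⟨ ℚP.+-identityˡ (fromℕ (suc n) * S) ⟨
    0ℚ + fromℕ (suc n) * S                       ≡⟨ cong₂ (λ a b → a + fromℕ (suc n) * b) ∑c≡0 ∑cδ≡S ⟨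
    ∑ c + fromℕ (suc n) * ∑ (λ j → c j * δ j)    ≡⟨ ∑-lift-head c δ y ⟨
    ∑ (λ j → c j * lift (δ j) (y j) zero)        ≡⟨ c-kills′ zero ⟩
    0ℚ                                           ≡⟨ ℚP.*-zeroʳ (fromℕ (suc n)) ⟨
    fromℕ (suc n) * 0ℚ                           ∎)
  c₀≡0 : c zero ≡ 0ℚ
  c₀≡0 = trans (sym (ℚP.+-identityʳ (c zero))) (trans (cong (c zero +_) (sym S≡0)) ∑c≡0)
  pad : ∀ b a → a ≡ 0ℚ * b + a + (0ℚ - 0ℚ)
  pad = solve-∀ ℚ-ring
  tail-kills : ∀ i → ∑ (λ j → c (suc j) * basePoints n j i) ≡ 0ℚ
  tail-kills i = begin
    A                                                    ≡⟨ pad (basePoints n zero i) A ⟩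
    0ℚ * basePoints n zero i + A + (0ℚ - 0ℚ)
      ≡⟨ cong₂ (λ u v → u * basePoints n zero i + A + v) (sym c₀≡0) (sym (cong₂ _-_ ∑c≡0 (trans ∑cδ≡S S≡0))) ⟩
    ∑ (λ j → c j * y j i) + (∑ c - ∑ (λ j → c j * δ j))  ≡⟨ ∑-lift-tail c δ y i ⟨
    ∑ (λ j → c j * lift (δ j) (y j) (suc i))             ≡⟨ c-kills′ (suc i) ⟩
    0ℚ                                                   ∎
    where
    A = ∑ (λ j → c (suc j) * basePoints n j i)
  c≡0 : ∀ j → c j ≡ 0ℚ
  c≡0 zero    = c₀≡0
  c≡0 (suc j) = basePoints-independent n (c ∘ suc) S≡0 tail-kills j

Q-affDim : ∀ n → AffDim (Q (suc n)) n
Q-affDim n = (basePoints n , basePoints-∈Q n , basePoints-independent n) ,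
             λ p p∈Q → hyperplane-dependent p (λ j → Q-sums-equal (p∈Q j) (p∈Q zero))

affIndep-reindex : ∀ {n k} {p : Fin (suc k) → Point n} (π : Fin n → Fin n) → (∀ i → π (π i) ≡ i) →
                   AffIndep p → AffIndep (λ j → p j ∘ π)
affIndep-reindex {p = p} π π-involutive p-indep c ∑c≡0 c-kills = p-indep c ∑c≡0
  (λ i → subst (λ i′ → ∑ (λ j → c j * p j i′) ≡ 0ℚ) (π-involutive i) (c-kills (π i)))

P-affDim : ∀ n → AffDim (P132-312 (suc n)) n
P-affDim n = ((λ j → basePoints n j ∘ opposite) , Q⇒P ∘ basePoints-∈Q n ,
              affIndep-reindex {p = basePoints n} opposite FP.opposite-involutive (basePoints-independent n)) ,
             λ q q∈P → proj₂ (Q-affDim n) (λ j → q j ∘ opposite) (P⇒Q ∘ q∈P)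
                       ∘ affIndep-reindex {p = q} opposite FP.opposite-involutive

record Enumeration {A : Set} (P : A → Set) : Set where
  constructor enumeration
  field
    elements : List A
    unique   : Unique elements
    sound    : ∀ {x} → x ∈ elements → P x
    complete : ∀ {x} → P x → x ∈ elements

open Enumeration using (elements)

enum-⇔ : ∀ {A : Set} {P P′ : A → Set} → (∀ {x} → P x → P′ x) → (∀ {x} → P′ x → P x) →
         Enumeration P → Enumeration P′
enum-⇔ to from (enumeration xs xs-unique xs-sound xs-complete) =
  enumeration xs xs-unique (to ∘ xs-sound) (xs-complete ∘ from)

enum-involution : ∀ {A : Set} {P : A → Set} (f : A → A) → (∀ x → f (f x) ≡ x) →
                  Enumeration P → Enumeration (P ∘ f)
enum-involution {P = P} f f-involutive (enumeration xs xs-unique xs-sound xs-complete) =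
  enumeration (map f xs) (Unique.map⁺ f-injective xs-unique) sound′ complete′
  where
  f-injective : ∀ {x y} → f x ≡ f y → x ≡ y
  f-injective {x} {y} fx≡fy = trans (sym (f-involutive x)) (trans (cong f fx≡fy) (f-involutive y))
  sound′ : ∀ {x} → x ∈ map f xs → P (f x)
  sound′ x∈ with ∈-map⁻ f x∈
  ... | y , y∈xs , refl = subst P (sym (f-involutive y)) (xs-sound y∈xs)
  complete′ : ∀ {x} → P (f x) → x ∈ map f xs
  complete′ {x} Pfx = subst (_∈ map f xs) (f-involutive x) (∈-map⁺ f (xs-complete Pfx))

module _ {A : Set} {n : ℕ} where

  extensions : List A → (A → List (Vec A n)) → List (Vec A (suc n))
  extensions []       _  = []
  extensions (h ∷ hs) vs = map (h Vec.∷_) (vs h) List.++ extensions hs vs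

  ∈-extensions⁺ : ∀ {hs vs h v} → h ∈ hs → v ∈ vs h → (h Vec.∷ v) ∈ extensions hs vs
  ∈-extensions⁺ {h ∷ _}       (here refl) v∈ = ∈-++⁺ˡ (∈-map⁺ (h Vec.∷_) v∈)
  ∈-extensions⁺ {h′ ∷ _} {vs} (there h∈)  v∈ = ∈-++⁺ʳ (map (h′ Vec.∷_) (vs h′)) (∈-extensions⁺ h∈ v∈)

  ∈-extensions⁻ : ∀ hs vs {h v} → (h Vec.∷ v) ∈ extensions hs vs → h ∈ hs × v ∈ vs h
  ∈-extensions⁻ (h′ ∷ hs) vs hv∈ with ∈-++⁻ (map (h′ Vec.∷_) (vs h′)) hv∈
  ... | inj₂ hv∈rest = map₁ there (∈-extensions⁻ hs vs hv∈rest)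
  ... | inj₁ hv∈map with ∈-map⁻ (h′ Vec.∷_) hv∈map
  ...   | _ , v∈ , refl = here refl , v∈

  extensions-unique : ∀ {hs vs} → Unique hs → (∀ h → Unique (vs h)) → Unique (extensions hs vs)
  extensions-unique {[]}          _                 _         = []
  extensions-unique {h ∷ hs} {vs} (h∉hs ∷ hs-unique) vs-unique =
    Unique.++⁺ (Unique.map⁺ ∷-injectiveʳ (vs-unique h)) (extensions-unique hs-unique vs-unique) disjoint
    where
    disjoint : ∀ {u} → ¬ (u ∈ map (h Vec.∷_) (vs h) × u ∈ extensions hs vs)
    disjoint (u∈map , u∈rest) with ∈-map⁻ (h Vec.∷_) u∈map
    ... | _ , _ , refl = All.lookup h∉hs (proj₁ (∈-extensions⁻ hs vs u∈rest)) refl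

  length-extensions : ∀ h hs vs → length (extensions (h ∷ hs) vs) ≡ length (vs h) ℕ.+ length (extensions hs vs)
  length-extensions h hs vs = trans (length-++ (map (h Vec.∷_) (vs h))) (cong (ℕ._+ _) (length-map (h Vec.∷_) (vs h)))

  extensions-length-≥ : ∀ {a} hs vs → (∀ h → a ℕ.≤ length (vs h)) → length hs ℕ.* a ℕ.≤ length (extensions hs vs)
  extensions-length-≥ []       vs _     = z≤n
  extensions-length-≥ (h ∷ hs) vs a≤vs = subst (_ ℕ.≤_) (sym (length-extensions h hs vs))
    (ℕP.+-mono-≤ (a≤vs h) (extensions-length-≥ hs vs a≤vs))

  extensions-length-≤ : ∀ {b} hs vs → (∀ h → length (vs h) ℕ.≤ b) → length (extensions hs vs) ℕ.≤ length hs ℕ.* b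
  extensions-length-≤ []       vs _     = z≤n
  extensions-length-≤ (h ∷ hs) vs vs≤b = subst (ℕ._≤ _) (sym (length-extensions h hs vs))
    (ℕP.+-mono-≤ (vs≤b h) (extensions-length-≤ hs vs vs≤b))

enum-∷ : ∀ {A : Set} {n} {H : A → Set} {F : A → Vec A n → Set} →
         (EH : Enumeration H) (EF : ∀ h → Enumeration (F h)) →
         Enumeration (λ v → H (Vec.head v) × F (Vec.head v) (Vec.tail v))
enum-∷ {H = H} {F} EH EF = enumeration (extensions (elements EH) (elements ∘ EF))
  (extensions-unique (Enumeration.unique EH) (Enumeration.unique ∘ EF)) sound′ complete′
  where
  sound′ : ∀ {v} → v ∈ extensions (elements EH) (elements ∘ EF) → H (Vec.head v) × F (Vec.head v) (Vec.tail v)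
  sound′ {h Vec.∷ v} hv∈ with ∈-extensions⁻ (elements EH) (elements ∘ EF) hv∈
  ... | h∈ , v∈ = Enumeration.sound EH h∈ , Enumeration.sound (EF h) v∈
  complete′ : ∀ {v} → H (Vec.head v) × F (Vec.head v) (Vec.tail v) → v ∈ extensions (elements EH) (elements ∘ EF)
  complete′ {h Vec.∷ v} (Hh , Fhv) = ∈-extensions⁺ (Enumeration.complete EH Hh) (Enumeration.complete (EF h) Fhv)

lookup-injective : ∀ {A : Set} {xs : List A} → Unique xs → Injective _≡_ _≡_ (List.lookup xs)
lookup-injective {xs = _ ∷ _} (_ ∷ _)      {zero}  {zero}  _ = refl
lookup-injective {xs = _ ∷ _} (x∉ ∷ _)     {zero}  {suc j} e = ⊥-elim (All.lookup x∉ (∈-lookup j) e)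
lookup-injective {xs = _ ∷ _} (x∉ ∷ _)     {suc i} {zero}  e = ⊥-elim (All.lookup x∉ (∈-lookup i) (sym e))
lookup-injective {xs = _ ∷ _} (_ ∷ unique) {suc i} {suc j} e = cong suc (lookup-injective unique e)

module _ {n} {P : PointSet n} {t} .{{_ : ℕ.NonZero t}} where

  latticeCount : (E : Enumeration (InDilate P t)) → LatticeCount P t (length (elements E))
  latticeCount (enumeration zs zs-unique zs-sound zs-complete) =
    List.lookup zs , lookup-injective zs-unique , zs-sound ∘ ∈-lookup ,
    λ z z∈tP → Any.index (zs-complete z∈tP) , sym (lookup-index (zs-complete z∈tP))

  latticeCount-unique : ∀ {M N} → LatticeCount P t M → LatticeCount P t N → M ≡ N
  latticeCount-unique c d = ℕP.≤-antisym (count-≤ c d) (count-≤ d c)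
    where
    count-≤ : ∀ {M N} → LatticeCount P t M → LatticeCount P t N → M ℕ.≤ N
    count-≤ (f , f-injective , f∈tP , _) (g , _ , _ , g-onto) = FP.injective⇒≤ {f = h} h-injective
      where
      h = λ j → proj₁ (g-onto (f j) (f∈tP j))
      h-injective : Injective _≡_ _≡_ h
      h-injective {i} {j} hi≡hj = f-injective (begin
        f i            ≡⟨ proj₂ (g-onto (f i) (f∈tP i)) ⟨
        g (h i)        ≡⟨ cong g hi≡hj ⟩
        g (h j)        ≡⟨ proj₂ (g-onto (f j) (f∈tP j)) ⟩
        f j            ∎)
        where open ≡-Reasoning

InWindow : ℕ → ℤ → ℕ → ℤ → Set
InWindow m σ L z = σ ℤ.≤ ℤ.+ m ℤ.* z × ℤ.+ m ℤ.* z ℤ.≤ σ ℤ.+ ℤ.+ m ℤ.* ℤ.+ L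

range : ℤ → ℕ → List ℤ
range lo k = applyUpTo (λ i → lo ℤ.+ ℤ.+ i) k

∈-range⁻ : ∀ {lo k z} → z ∈ range lo k → lo ℤ.≤ z × z ℤ.< lo ℤ.+ ℤ.+ k
∈-range⁻ {lo} z∈ with ∈-applyUpTo⁻ (λ i → lo ℤ.+ ℤ.+ i) z∈
... | i , i<k , refl = ℤP.i≤i+j lo (ℤ.+ i) , ℤP.+-monoʳ-< lo (ℤ.+<+ i<k)

∈-range⁺ : ∀ {lo k z} → lo ℤ.≤ z → z ℤ.< lo ℤ.+ ℤ.+ k → z ∈ range lo k
∈-range⁺ {lo} {k} {z} lo≤z z<lo+k = subst (_∈ range lo k) lo+i≡z (∈-applyUpTo⁺ (λ i → lo ℤ.+ ℤ.+ i) i<k)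
  where
  i = ℤ.∣ z ℤ.- lo ∣
  +i≡z-lo : ℤ.+ i ≡ z ℤ.- lo
  +i≡z-lo = ℤP.0≤i⇒+∣i∣≡i (ℤP.i≤j⇒0≤j-i lo≤z)
  lo+i≡z : lo ℤ.+ ℤ.+ i ≡ z
  lo+i≡z = trans (cong (λ j → lo ℤ.+ j) +i≡z-lo) (lo+[z-lo]≡z lo z)
    where
    lo+[z-lo]≡z : ∀ lo z → lo ℤ.+ (z ℤ.- lo) ≡ z
    lo+[z-lo]≡z = ℤRing.solve-∀
  i<k : i ℕ.< k
  i<k = ℕP.≰⇒> λ k≤i → ℤP.<⇒≱ (subst (ℤ._< lo ℤ.+ ℤ.+ k) (sym lo+i≡z) z<lo+k)
                               (ℤP.+-monoʳ-≤ lo (ℤ.+≤+ k≤i))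

range-unique : ∀ lo k → Unique (range lo k)
range-unique lo k = Unique.applyUpTo⁺₁ (λ i → lo ℤ.+ ℤ.+ i) k
  (λ i<j _ → ℤP.<⇒≢ (ℤP.+-monoʳ-< lo (ℤ.+<+ i<j)))

inWindow? : ∀ m σ L → Decidable (InWindow m σ L)
inWindow? m σ L z = (σ ℤP.≤? ℤ.+ m ℤ.* z) ×-dec (ℤ.+ m ℤ.* z ℤP.≤? σ ℤ.+ ℤ.+ m ℤ.* ℤ.+ L)

module Window (k : ℕ) (σ : ℤ) (L : ℕ) where

  private
    M : ℤ
    M = ℤ.+ suc k

    1+[a-1]≡a : ∀ a → ℤ.1ℤ ℤ.+ (a ℤ.- ℤ.1ℤ) ≡ a
    1+[a-1]≡a = ℤRing.solve-∀

  -- ⌈σ/m⌉ - 1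
  q : ℤ
  q = (σ ℤ.- ℤ.1ℤ) /ℕ suc k

  lowest highest : ℤ
  lowest  = ℤ.suc q
  highest = lowest ℤ.+ ℤ.+ L

  Mq<σ : M ℤ.* q ℤ.< σ
  Mq<σ = ℤP.suc[i]≤j⇒i<j (subst₂ ℤ._≤_ (cong ℤ.suc (ℤP.*-comm q M)) (1+[a-1]≡a σ)
           (ℤP.suc-mono ([n/ℕd]*d≤n (σ ℤ.- ℤ.1ℤ) (suc k))))

  σ≤M*lowest : σ ℤ.≤ M ℤ.* lowest
  σ≤M*lowest = subst₂ ℤ._≤_ (1+[a-1]≡a σ) (ℤP.*-comm lowest M)
                 (ℤP.i<j⇒suc[i]≤j (n<s[n/ℕd]*d (σ ℤ.- ℤ.1ℤ) (suc k)))

  lowest≤ : ∀ {z} → InWindow (suc k) σ L z → lowest ℤ.≤ z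
  lowest≤ {z} (σ≤Mz , _) = ℤP.≮⇒≥ z≮lowest
    where
    z≮lowest : ¬ z ℤ.< lowest
    z≮lowest z<lowest = ℤP.<-irrefl refl
      (ℤP.≤-<-trans (ℤP.*-monoˡ-≤-nonNeg M z≤q) (ℤP.<-≤-trans Mq<σ σ≤Mz))
      where
      z≤q : z ℤ.≤ q
      z≤q = subst (z ℤ.≤_) (ℤP.pred-suc q) (ℤP.i<j⇒i≤pred[j] z<lowest)

  ≤highest : ∀ {z} → InWindow (suc k) σ L z → z ℤ.≤ highest
  ≤highest {z} (_ , Mz≤σ+ML) = ℤP.*-cancelˡ-≤-pos z highest M (begin
    M ℤ.* z                       ≤⟨ Mz≤σ+ML ⟩
    σ ℤ.+ M ℤ.* ℤ.+ L             ≤⟨ ℤP.+-monoˡ-≤ (M ℤ.* ℤ.+ L) σ≤M*lowest ⟩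
    M ℤ.* lowest ℤ.+ M ℤ.* ℤ.+ L  ≡⟨ ℤP.*-distribˡ-+ M lowest (ℤ.+ L) ⟨
    M ℤ.* highest                 ∎)
    where open ℤP.≤-Reasoning

  <highest⇒inWindow : ∀ {z} → lowest ℤ.≤ z → z ℤ.< highest → InWindow (suc k) σ L z
  <highest⇒inWindow {z} lowest≤z z<highest =
    ℤP.≤-trans σ≤M*lowest (ℤP.*-monoˡ-≤-nonNeg M lowest≤z) , ℤP.<⇒≤ (begin-strict
      M ℤ.* z                  ≤⟨ ℤP.*-monoˡ-≤-nonNeg M z≤q+L ⟩
      M ℤ.* (q ℤ.+ ℤ.+ L)      ≡⟨ ℤP.*-distribˡ-+ M q (ℤ.+ L) ⟩
      M ℤ.* q ℤ.+ M ℤ.* ℤ.+ L  <⟨ ℤP.+-monoˡ-< (M ℤ.* ℤ.+ L) Mq<σ ⟩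
      σ ℤ.+ M ℤ.* ℤ.+ L        ∎)
    where
    open ℤP.≤-Reasoning
    z≤q+L : z ℤ.≤ q ℤ.+ ℤ.+ L
    z≤q+L = subst (z ℤ.≤_) (ℤP.pred-suc (q ℤ.+ ℤ.+ L))
      (ℤP.i<j⇒i≤pred[j] (subst (z ℤ.<_) (ℤP.+-assoc ℤ.1ℤ q (ℤ.+ L)) z<highest))

  top : List ℤ
  top = filter (inWindow? (suc k) σ L) (highest ∷ [])

  window-list : List ℤ
  window-list = range lowest L List.++ top

  window : Enumeration (InWindow (suc k) σ L)
  window = enumeration window-list
    (Unique.++⁺ (range-unique lowest L) (Unique.filter⁺ (inWindow? (suc k) σ L) {highest ∷ []} (All.[] ∷ [])) disjoint)
    sound′ complete′
    where
    disjoint : ∀ {z} → ¬ (z ∈ range lowest L × z ∈ top)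
    disjoint (z∈range , z∈top) with proj₁ (∈-filter⁻ (inWindow? (suc k) σ L) z∈top)
    ... | here refl = ℤP.<-irrefl refl (proj₂ (∈-range⁻ {lowest} z∈range))
    sound′ : ∀ {z} → z ∈ window-list → InWindow (suc k) σ L z
    sound′ z∈ with ∈-++⁻ (range lowest L) z∈
    ... | inj₁ z∈range = uncurry <highest⇒inWindow (∈-range⁻ z∈range)
    ... | inj₂ z∈top   = proj₂ (∈-filter⁻ (inWindow? (suc k) σ L) z∈top)
    complete′ : ∀ {z} → InWindow (suc k) σ L z → z ∈ window-list
    complete′ {z} z∈W with ℤP.<-cmp z highest
    ... | tri< z<highest _ _ = ∈-++⁺ˡ (∈-range⁺ (lowest≤ z∈W) z<highest)
    ... | tri≈ _ refl _      = ∈-++⁺ʳ (range lowest L) (∈-filter⁺ (inWindow? (suc k) σ L) (here refl) z∈W)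
    ... | tri> _ _ z>highest = ⊥-elim (ℤP.<⇒≱ z>highest (≤highest z∈W))

  length-window : length (elements window) ≡ L ℕ.+ length top
  length-window = trans (length-++ (range lowest L)) (cong (ℕ._+ length top) (length-applyUpTo (λ i → lowest ℤ.+ ℤ.+ i) L))

  window-length-≥ : L ℕ.≤ length (elements window)
  window-length-≥ = subst (L ℕ.≤_) (sym length-window) (ℕP.m≤m+n L (length top))

  window-length-≤ : length (elements window) ℕ.≤ suc L
  window-length-≤ = subst₂ ℕ._≤_ (sym length-window) (ℕP.+-comm L 1)
    (ℕP.+-monoʳ-≤ L (length-filter (inWindow? (suc k) σ L) (highest ∷ [])))

window-length-unit : ∀ σ L → length (elements (Window.window 0 σ L)) ≡ suc L
window-length-unit σ L = begin
  length (elements window)                               ≡⟨ length-window ⟩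
  L ℕ.+ length (filter (inWindow? 1 σ L) (highest ∷ [])) ≡⟨ cong (λ xs → L ℕ.+ length xs) (filter-accept (inWindow? 1 σ L) highest∈W) ⟩
  L ℕ.+ 1                                                ≡⟨ ℕP.+-comm L 1 ⟩
  suc L                                                  ∎
  where
  open Window 0 σ L
  open ≡-Reasoning
  lowest≡σ : lowest ≡ σ
  lowest≡σ = ℤP.≤-antisym (ℤP.i<j⇒suc[i]≤j (subst (ℤ._< σ) (ℤP.*-identityˡ q) Mq<σ))
                          (subst (σ ℤ.≤_) (ℤP.*-identityˡ lowest) σ≤M*lowest)
  1*highest≡σ+L : ℤ.+ 1 ℤ.* highest ≡ σ ℤ.+ ℤ.+ L
  1*highest≡σ+L = trans (ℤP.*-identityˡ highest) (cong (ℤ._+ ℤ.+ L) lowest≡σ)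
  highest∈W : InWindow 1 σ L highest
  highest∈W = subst (σ ℤ.≤_) (sym 1*highest≡σ+L) (ℤP.i≤i+j σ (ℤ.+ L)) ,
              ℤP.≤-reflexive (trans 1*highest≡σ+L (cong (ℤ._+_ σ) (sym (ℤP.*-identityˡ (ℤ.+ L)))))

-- Lattice points of the dilates

between : ∀ {a b : ℤ} {c : ℕ} {μ} → 0ℚ ≤ μ → μ ≤ 1ℚ → fromℤ a ≡ fromℤ b + fromℕ c * μ →
          b ℤ.≤ a × a ℤ.≤ b ℤ.+ ℤ.+ c
between {a} {b} {c} {μ} 0≤μ μ≤1 a≡ = fromℤ-cancel-≤ b≤a , fromℤ-cancel-≤ a≤b+c
  where
  open ℚP.≤-Reasoning
  b≤a : fromℤ b ≤ fromℤ a
  b≤a = begin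
    fromℤ b                ≡⟨ ℚP.+-identityʳ (fromℤ b) ⟨
    fromℤ b + 0ℚ           ≤⟨ ℚP.+-monoʳ-≤ (fromℤ b) (nonNeg-* (fromℕ-nonNeg c) 0≤μ) ⟩
    fromℤ b + fromℕ c * μ  ≡⟨ a≡ ⟨
    fromℤ a                ∎
  a≤b+c : fromℤ a ≤ fromℤ (b ℤ.+ ℤ.+ c)
  a≤b+c = begin
    fromℤ a                ≡⟨ a≡ ⟩
    fromℤ b + fromℕ c * μ  ≤⟨ ℚP.+-monoʳ-≤ (fromℤ b) (ℚP.*-monoˡ-≤-nonNeg (fromℕ c) {{ℚ.nonNegative (fromℕ-nonNeg c)}} μ≤1) ⟩
    fromℤ b + fromℕ c * 1ℚ ≡⟨ cong (fromℤ b +_) (ℚP.*-identityʳ (fromℕ c)) ⟩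
    fromℤ b + fromℕ c      ≡⟨ fromℤ-+ b (ℤ.+ c) ⟨
    fromℤ (b ℤ.+ ℤ.+ c)    ∎

between⁻¹ : ∀ {a b : ℤ} {c : ℕ} → b ℤ.≤ a → a ℤ.≤ b ℤ.+ ℤ.+ c →
            Σ ℚ λ μ → 0ℚ ≤ μ × μ ≤ 1ℚ × fromℤ a ≡ fromℤ b + fromℕ c * μ
between⁻¹ {a} {b} {zero}  b≤a a≤b+0 = 0ℚ , ℚP.≤-refl , 0≤1 , (begin
  fromℤ a        ≡⟨ cong fromℤ (ℤP.≤-antisym (subst (a ℤ.≤_) (ℤP.+-identityʳ b) a≤b+0) b≤a) ⟩
  fromℤ b        ≡⟨ ℚP.+-identityʳ (fromℤ b) ⟨
  fromℤ b + 0ℚ   ∎)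
  where open ≡-Reasoning
between⁻¹ {a} {b} {suc c} b≤a a≤b+c = μ , 0≤μ , μ≤1 , a≡
  where
  C = fromℕ (suc c)
  D = fromℤ a - fromℤ b
  μ = D * ℚ.1/ C
  C*μ≡D : C * μ ≡ D
  C*μ≡D = trans (sym (ℚP.*-assoc C D (ℚ.1/ C))) (trans (cong (_* ℚ.1/ C) (ℚP.*-comm C D))
            (trans (ℚP.*-assoc D C (ℚ.1/ C)) (trans (cong (D *_) (ℚP.*-inverseʳ C)) (ℚP.*-identityʳ D))))
  0≤D : 0ℚ ≤ D
  0≤D = ≤⇒0≤- (fromℤ-mono-≤ b≤a)
  D≤C : D ≤ C
  D≤C = 0≤-⇒≤ (subst (0ℚ ≤_) (rearrange (fromℤ a) (fromℤ b) C)
          (≤⇒0≤- (subst (fromℤ a ≤_) (fromℤ-+ b (ℤ.+ suc c)) (fromℤ-mono-≤ a≤b+c))))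
    where
    rearrange : ∀ a b c → b + c - a ≡ c - (a - b)
    rearrange = solve-∀ ℚ-ring
  0≤μ : 0ℚ ≤ μ
  0≤μ = ℚP.*-cancelˡ-≤-pos C (subst₂ _≤_ (sym (ℚP.*-zeroʳ C)) (sym C*μ≡D) 0≤D)
  μ≤1 : μ ≤ 1ℚ
  μ≤1 = ℚP.*-cancelˡ-≤-pos C (subst₂ _≤_ (sym C*μ≡D) (sym (ℚP.*-identityʳ C)) D≤C)
  a≡ : fromℤ a ≡ fromℤ b + C * μ
  a≡ = trans (b+[a-b]≡a (fromℤ a) (fromℤ b)) (cong (fromℤ b +_) (sym C*μ≡D))
    where
    b+[a-b]≡a : ∀ a b → a ≡ b + (a - b)
    b+[a-b]≡a = solve-∀ ℚ-ring

*-/-cancel : ∀ m .{{_ : ℕ.NonZero m}} a → fromℕ m * (a / m) ≡ fromℤ a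
*-/-cancel (suc m) a = ℚP.toℚᵘ-injective (ℚᵘP.≃-trans (ℚP.toℚᵘ-homo-* (fromℕ (suc m)) (a / suc m))
  (ℚᵘP.≃-trans (ℚᵘP.*-congˡ {ℚᵘ.mkℚᵘ (ℤ.+ suc m) 0} (ℚP.toℚᵘ-fromℚᵘ (ℚᵘ.mkℚᵘ a m))) (ℚᵘ.*≡* cross)))
  where
  cross : (ℤ.+ suc m ℤ.* a) ℤ.* ℤ.+ 1 ≡ a ℤ.* ℤ.+ suc (m ℕ.+ 0)
  cross = trans (ma1≡am (ℤ.+ suc m) a) (cong (λ k → a ℤ.* ℤ.+ suc k) (sym (ℕP.+-identityʳ m)))
    where
    ma1≡am : ∀ m a → (m ℤ.* a) ℤ.* ℤ.+ 1 ≡ a ℤ.* m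
    ma1≡am = ℤRing.solve-∀

head-scaling : ∀ {N K a s x₀} μ → (1ℚ + N) * K * x₀ ≡ (1ℚ + N) * a - s → x₀ ≡ 1ℚ + N * μ →
               (1ℚ + N) * a ≡ (s + (1ℚ + N) * K) + (1ℚ + N) * (N * K) * μ
head-scaling {N} {K} {a} {s} μ MKx₀≡ refl = begin
  (1ℚ + N) * a                               ≡⟨ solve (N ∷ a ∷ s ∷ []) ℚ-ring ⟩
  ((1ℚ + N) * a - s) + s                     ≡⟨ cong (_+ s) MKx₀≡ ⟨
  (1ℚ + N) * K * (1ℚ + N * μ) + s            ≡⟨ solve (N ∷ K ∷ s ∷ μ ∷ []) ℚ-ring ⟩
  (s + (1ℚ + N) * K) + (1ℚ + N) * (N * K) * μ ∎
  where open ≡-Reasoning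

head-scaling⁻¹ : ∀ {N K a s x₀} μ → (1ℚ + N) * K ≢ 0ℚ → (1ℚ + N) * K * x₀ ≡ (1ℚ + N) * a - s →
                 (1ℚ + N) * a ≡ (s + (1ℚ + N) * K) + (1ℚ + N) * (N * K) * μ → x₀ ≡ 1ℚ + N * μ
head-scaling⁻¹ {N} {K} {a} {s} {x₀} μ MK≢0 MKx₀≡ Ma≡ = *-cancelˡ-≡ MK≢0 (begin
  (1ℚ + N) * K * x₀                                   ≡⟨ MKx₀≡ ⟩
  (1ℚ + N) * a - s                                    ≡⟨ cong (_- s) Ma≡ ⟩
  (s + (1ℚ + N) * K) + (1ℚ + N) * (N * K) * μ - s     ≡⟨ solve (N ∷ K ∷ s ∷ μ ∷ []) ℚ-ring ⟩
  (1ℚ + N) * K * (1ℚ + N * μ)                         ∎)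
  where open ≡-Reasoning

tail-scaling : ∀ {N K a b s x₀ y μ} → 1ℚ + N ≢ 0ℚ → (1ℚ + N) * K * x₀ ≡ (1ℚ + N) * a - s → x₀ ≡ 1ℚ + N * μ →
               (1ℚ + N) * K * (y + (1ℚ - μ)) ≡ (1ℚ + N) * b - s → N * K * y ≡ N * b - (s + (1ℚ + N) * K - a)
tail-scaling {N} {K} {a} {b} {s} {x₀} {y} {μ} M≢0 MKx₀≡ refl MKy≡ = *-cancelˡ-≡ M≢0 (begin
  (1ℚ + N) * (N * K * y)
    ≡⟨ solve (N ∷ K ∷ y ∷ μ ∷ []) ℚ-ring ⟩
  N * ((1ℚ + N) * K * (y + (1ℚ - μ))) - (1ℚ + N) * K * (1ℚ + N) + (1ℚ + N) * K * (1ℚ + N * μ)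
    ≡⟨ cong₂ (λ u v → N * u - (1ℚ + N) * K * (1ℚ + N) + v) MKy≡ MKx₀≡ ⟩
  N * ((1ℚ + N) * b - s) - (1ℚ + N) * K * (1ℚ + N) + ((1ℚ + N) * a - s)
    ≡⟨ solve (N ∷ K ∷ a ∷ b ∷ s ∷ []) ℚ-ring ⟩
  (1ℚ + N) * (N * b - (s + (1ℚ + N) * K - a)) ∎)
  where open ≡-Reasoning

mirror : ∀ {n} → Vec ℤ n → Vec ℤ n
mirror z = Vec.tabulate (Vec.lookup z ∘ opposite)

lookup-mirror : ∀ {n} (z : Vec ℤ n) i → Vec.lookup (mirror z) i ≡ Vec.lookup z (opposite i)
lookup-mirror z = lookup∘tabulate (Vec.lookup z ∘ opposite)

mirror-involutive : ∀ {n} (z : Vec ℤ n) → mirror (mirror z) ≡ z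
mirror-involutive z = trans (tabulate-cong λ i → trans (lookup-mirror z (opposite i))
                                                       (cong (Vec.lookup z) (FP.opposite-involutive i)))
                            (tabulate∘lookup z)

slack : ℕ → ℕ
slack zero    = 0
slack (suc d) = suc (suc d) ℕ.* slack d ℕ.+ d !

module Dilated (T : ℕ) {{_ : ℕ.NonZero T}} where

  private
    K : ℚ
    K = fromℕ T

  shifted : ℕ → ℤ → ℤ
  shifted n σ = σ ℤ.+ ℤ.+ (suc n ℕ.* T)

  -- (z - (σ/m)·𝟙) / T ∈ Q_m, unfolded coordinate by coordinate as in Q-peel
  Admissible : (m : ℕ) → ℤ → Vec ℤ m → Set
  Admissible zero    σ _ = ⊤
  Admissible (suc n) σ v = InWindow (suc n) (shifted n σ) (n ℕ.* T) (Vec.head v)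
                         × Admissible n (shifted n σ ℤ.- Vec.head v) (Vec.tail v)

  -- x = (z - (σ/m)·𝟙) / T, written without dividing by m, which is 0 in the base case
  Scaled : (m : ℕ) → ℤ → Vec ℤ m → Point m → Set
  Scaled m σ z x = ∀ i → fromℕ (m ℕ.* T) * x i ≡ fromℤ (ℤ.+ m ℤ.* Vec.lookup z i ℤ.- σ)

  private
    M≢0 : ∀ n → 1ℚ + fromℕ n ≢ 0ℚ
    M≢0 n = fromℕ-≢0 {suc n} (λ ()) ∘ trans (fromℕ-suc n)

    MK≢0 : ∀ n → (1ℚ + fromℕ n) * K ≢ 0ℚ
    MK≢0 n = *-≢0 (M≢0 n) (fromℕ-≢0 (ℕ.≢-nonZero⁻¹ T))

    fromℕ-[1+n]*T : ∀ n → fromℕ (suc n ℕ.* T) ≡ (1ℚ + fromℕ n) * K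
    fromℕ-[1+n]*T n = trans (fromℕ-* (suc n) T) (cong (_* K) (fromℕ-suc n))

    fromℤ-[1+n]*z : ∀ n z → fromℤ (ℤ.+ suc n ℤ.* z) ≡ (1ℚ + fromℕ n) * fromℤ z
    fromℤ-[1+n]*z n z = trans (fromℤ-* (ℤ.+ suc n) z) (cong (_* fromℤ z) (fromℕ-suc n))

    fromℤ-shifted : ∀ n σ → fromℤ (shifted n σ) ≡ fromℤ σ + (1ℚ + fromℕ n) * K
    fromℤ-shifted n σ = trans (fromℤ-+ σ _) (cong (fromℤ σ +_) (fromℕ-[1+n]*T n))

    fromℕ-width : ∀ n → fromℕ (suc n ℕ.* (n ℕ.* T)) ≡ (1ℚ + fromℕ n) * (fromℕ n * K)
    fromℕ-width n = trans (fromℕ-* (suc n) (n ℕ.* T)) (cong₂ _*_ (fromℕ-suc n) (fromℕ-* n T))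

    scaled-entry : ∀ n σ b y → fromℕ (suc n ℕ.* T) * y ≡ fromℤ (ℤ.+ suc n ℤ.* b ℤ.- σ) →
                   (1ℚ + fromℕ n) * K * y ≡ (1ℚ + fromℕ n) * fromℤ b - fromℤ σ
    scaled-entry n σ b y e = begin
      (1ℚ + fromℕ n) * K * y              ≡⟨ cong (_* y) (fromℕ-[1+n]*T n) ⟨
      fromℕ (suc n ℕ.* T) * y             ≡⟨ e ⟩
      fromℤ (ℤ.+ suc n ℤ.* b ℤ.- σ)       ≡⟨ fromℤ-- (ℤ.+ suc n ℤ.* b) σ ⟩
      fromℤ (ℤ.+ suc n ℤ.* b) - fromℤ σ   ≡⟨ cong (_- fromℤ σ) (fromℤ-[1+n]*z n b) ⟩
      (1ℚ + fromℕ n) * fromℤ b - fromℤ σ  ∎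
      where open ≡-Reasoning

    window-bound≡ : ∀ n σ μ → fromℤ (shifted n σ) + fromℕ (suc n ℕ.* (n ℕ.* T)) * μ
                            ≡ (fromℤ σ + (1ℚ + fromℕ n) * K) + (1ℚ + fromℕ n) * (fromℕ n * K) * μ
    window-bound≡ n σ μ = cong₂ (λ u v → u + v * μ) (fromℤ-shifted n σ) (fromℕ-width n)

    window-width : ∀ n → ℤ.+ (suc n ℕ.* (n ℕ.* T)) ≡ ℤ.+ suc n ℤ.* ℤ.+ (n ℕ.* T)
    window-width n = ℤP.pos-* (suc n) (n ℕ.* T)

    scaled-tail : ∀ {n σ z zs x μ} {y : Point n} → Scaled (suc n) σ (z Vec.∷ zs) x →
                  x zero ≡ 1ℚ + fromℕ n * μ → (∀ i → x (suc i) ≡ y i + (1ℚ - μ)) →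
                  Scaled n (shifted n σ ℤ.- z) zs y
    scaled-tail {n} {σ} {z} {zs} {x} {μ} {y} x-scaled x₀≡ x≗ i = begin
      fromℕ (n ℕ.* T) * y i
        ≡⟨ cong (_* y i) (fromℕ-* n T) ⟩
      fromℕ n * K * y i
        ≡⟨ tail-scaling {fromℕ n} {K} {fromℤ z} {b} {fromℤ σ} {x zero} {y i} {μ} (M≢0 n)
             (scaled-entry n σ z (x zero) (x-scaled zero)) x₀≡
             (trans (cong ((1ℚ + fromℕ n) * K *_) (sym (x≗ i)))
                    (scaled-entry n σ (Vec.lookup zs i) (x (suc i)) (x-scaled (suc i)))) ⟩
      fromℕ n * b - (fromℤ σ + (1ℚ + fromℕ n) * K - fromℤ z)
        ≡⟨ cong₂ (λ u v → u - (v - fromℤ z)) (fromℤ-* (ℤ.+ n) (Vec.lookup zs i)) (fromℤ-shifted n σ) ⟨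
      fromℤ (ℤ.+ n ℤ.* Vec.lookup zs i) - (fromℤ (shifted n σ) - fromℤ z)
        ≡⟨ cong (_-_ (fromℤ (ℤ.+ n ℤ.* Vec.lookup zs i))) (fromℤ-- (shifted n σ) z) ⟨
      fromℤ (ℤ.+ n ℤ.* Vec.lookup zs i) - fromℤ (shifted n σ ℤ.- z)
        ≡⟨ fromℤ-- (ℤ.+ n ℤ.* Vec.lookup zs i) (shifted n σ ℤ.- z) ⟨
      fromℤ (ℤ.+ n ℤ.* Vec.lookup zs i ℤ.- (shifted n σ ℤ.- z)) ∎
      where
      open ≡-Reasoning
      b = fromℤ (Vec.lookup zs i)

  Q⇒admissible : ∀ m {σ z x} → Scaled m σ z x → Q m x → Admissible m σ z
  Q⇒admissible zero    _ _ = tt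
  Q⇒admissible (suc n) {σ} {z Vec.∷ zs} {x} x-scaled x∈Q with Q-peel x∈Q
  ... | lifted μ 0≤μ μ≤1 y y∈Q x≗ =
    in-window , Q⇒admissible n (scaled-tail {x = x} {μ = μ} {y = y} x-scaled (x≗ zero) (x≗ ∘ suc)) y∈Q
    where
    Mz≡ : fromℤ (ℤ.+ suc n ℤ.* z) ≡ fromℤ (shifted n σ) + fromℕ (suc n ℕ.* (n ℕ.* T)) * μ
    Mz≡ = trans (fromℤ-[1+n]*z n z) (trans
      (head-scaling {fromℕ n} {K} {fromℤ z} {fromℤ σ} μ (scaled-entry n σ z (x zero) (x-scaled zero)) (x≗ zero))
      (sym (window-bound≡ n σ μ)))
    in-window : InWindow (suc n) (shifted n σ) (n ℕ.* T) z
    in-window with between 0≤μ μ≤1 Mz≡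
    ... | lower , upper = lower , subst (λ w → _ ℤ.≤ shifted n σ ℤ.+ w) (window-width n) upper

  admissible⇒Q : ∀ m {σ z x} → Scaled m σ z x → Admissible m σ z → Q m x
  admissible⇒Q zero    {x = x} _ _ = Q-zero x
  admissible⇒Q (suc n) {σ} {z Vec.∷ zs} {x} x-scaled ((lower , upper) , rest)
    with between⁻¹ lower (subst (λ w → _ ℤ.≤ shifted n σ ℤ.+ w) (sym (window-width n)) upper)
  ... | μ , 0≤μ , μ≤1 , Mz≡ =
    Q-lift (lifted μ 0≤μ μ≤1 y (admissible⇒Q n (scaled-tail {x = x} {μ = μ} {y = y} x-scaled x₀≡ y-shift) rest) x≗)
    where
    y : Point n
    y i = x (suc i) - (1ℚ - μ)
    x₀≡ : x zero ≡ 1ℚ + fromℕ n * μ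
    x₀≡ = head-scaling⁻¹ {fromℕ n} {K} {fromℤ z} {fromℤ σ} μ (MK≢0 n) (scaled-entry n σ z (x zero) (x-scaled zero))
            (trans (sym (fromℤ-[1+n]*z n z)) (trans Mz≡ (window-bound≡ n σ μ)))
    a≡a-c+c : ∀ a c → a ≡ a - c + c
    a≡a-c+c = solve-∀ ℚ-ring
    y-shift : ∀ i → x (suc i) ≡ y i + (1ℚ - μ)
    y-shift i = a≡a-c+c (x (suc i)) (1ℚ - μ)
    x≗ : ∀ i → x i ≡ lift μ y i
    x≗ zero    = x₀≡
    x≗ (suc i) = y-shift i

  admissible : ∀ m σ → Enumeration (Admissible m σ)
  admissible zero    σ = enumeration (Vec.[] ∷ []) (All.[] ∷ []) (λ _ → tt) λ { {Vec.[]} _ → here refl }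
  admissible (suc n) σ =
    enum-∷ (Window.window n (shifted n σ) (n ℕ.* T)) (λ z → admissible n (shifted n σ ℤ.- z))

  lowerCount : ℕ → ℕ
  lowerCount zero    = 1
  lowerCount (suc d) = d ! ℕ.* T ^ d

  upperCount : ℕ → ℕ
  upperCount zero    = 1
  upperCount (suc n) = suc (n ℕ.* T) ℕ.* upperCount n

  window-lowerCount : ∀ n σ →
    lowerCount (suc n) ℕ.≤ length (elements (Window.window n σ (n ℕ.* T))) ℕ.* lowerCount n
  window-lowerCount zero    σ = ℕP.≤-reflexive (cong (ℕ._* 1) (sym (window-length-unit σ 0)))
  window-lowerCount (suc d) σ = begin
    suc d ! ℕ.* T ^ suc d                ≡⟨ regroup (suc d) (d !) T (T ^ d) ⟩
    suc d ℕ.* T ℕ.* (d ! ℕ.* T ^ d)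
      ≤⟨ ℕP.*-monoˡ-≤ (d ! ℕ.* T ^ d) (Window.window-length-≥ (suc d) σ (suc d ℕ.* T)) ⟩
    length (elements (Window.window (suc d) σ (suc d ℕ.* T))) ℕ.* lowerCount (suc d) ∎
    where
    open ℕP.≤-Reasoning
    regroup : ∀ s f t p → s ℕ.* f ℕ.* (t ℕ.* p) ≡ s ℕ.* t ℕ.* (f ℕ.* p)
    regroup = ℕRing.solve-∀

  admissible-length : ∀ m σ → lowerCount m ℕ.≤ length (elements (admissible m σ))
                            × length (elements (admissible m σ)) ℕ.≤ upperCount m
  admissible-length zero    σ = ℕP.≤-refl , ℕP.≤-refl
  admissible-length (suc n) σ =
    ℕP.≤-trans (window-lowerCount n τ) (extensions-length-≥ window fibre (proj₁ ∘ fibre-length)) ,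
    ℕP.≤-trans (extensions-length-≤ window fibre (proj₂ ∘ fibre-length))
               (ℕP.*-monoˡ-≤ (upperCount n) (Window.window-length-≤ n τ (n ℕ.* T)))
    where
    τ = shifted n σ
    window = elements (Window.window n τ (n ℕ.* T))
    fibre = λ z → elements (admissible n (τ ℤ.- z))
    fibre-length = λ z → admissible-length n (τ ℤ.- z)

  latticePoints : ∀ n → Enumeration (InDilate (P132-312 n) T)
  latticePoints n =
    enum-⇔ (λ {z} → to {z}) (λ {z} → from {z}) (enum-involution mirror mirror-involutive (admissible n ℤ.0ℤ))
    where
    point : Vec ℤ n → Point n
    point z i = Vec.lookup z i / T
    scaled : ∀ z → Scaled n ℤ.0ℤ (mirror z) (point z ∘ opposite)
    scaled z i = begin
      fromℕ (n ℕ.* T) * (a / T)                           ≡⟨ cong (_* (a / T)) (fromℕ-* n T) ⟩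
      fromℕ n * K * (a / T)                               ≡⟨ ℚP.*-assoc (fromℕ n) K (a / T) ⟩
      fromℕ n * (K * (a / T))                             ≡⟨ cong (fromℕ n *_) (*-/-cancel T a) ⟩
      fromℕ n * fromℤ a                                   ≡⟨ fromℤ-* (ℤ.+ n) a ⟨
      fromℤ (ℤ.+ n ℤ.* a)                                 ≡⟨ cong fromℤ (ℤP.+-identityʳ (ℤ.+ n ℤ.* a)) ⟨
      fromℤ (ℤ.+ n ℤ.* a ℤ.- ℤ.0ℤ)                        ≡⟨ cong (λ b → fromℤ (ℤ.+ n ℤ.* b ℤ.- ℤ.0ℤ)) (lookup-mirror z i) ⟨
      fromℤ (ℤ.+ n ℤ.* Vec.lookup (mirror z) i ℤ.- ℤ.0ℤ) ∎
      where
      open ≡-Reasoning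
      a = Vec.lookup z (opposite i)
    to : ∀ {z} → Admissible n ℤ.0ℤ (mirror z) → InDilate (P132-312 n) T z
    to {z} z-admissible = conv-cong {S = V132-312 n}
      (Q⇒P {y = point z ∘ opposite} (admissible⇒Q n (scaled z) z-admissible)) (cong (point z) ∘ FP.opposite-involutive)
    from : ∀ {z} → InDilate (P132-312 n) T z → Admissible n ℤ.0ℤ (mirror z)
    from {z} z∈tP = Q⇒admissible n (scaled z) (P⇒Q z∈tP)

  upperCount-bound : ∀ d → T ℕ.* upperCount (suc d) ℕ.≤ (d ! ℕ.* T ℕ.+ slack d) ℕ.* T ^ d
  upperCount-bound zero    = ℕP.≤-reflexive (base T)
    where
    base : ∀ t → t ℕ.* ((1 ℕ.+ 0 ℕ.* t) ℕ.* 1) ≡ (1 ℕ.* t ℕ.+ 0) ℕ.* 1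
    base = ℕRing.solve-∀
  upperCount-bound (suc d) = begin
    T ℕ.* (suc (suc d ℕ.* T) ℕ.* upperCount (suc d))  ≡⟨ swap T (suc (suc d ℕ.* T)) (upperCount (suc d)) ⟩
    suc (suc d ℕ.* T) ℕ.* (T ℕ.* upperCount (suc d))  ≤⟨ ℕP.*-monoʳ-≤ (suc (suc d ℕ.* T)) (upperCount-bound d) ⟩
    suc (suc d ℕ.* T) ℕ.* ((d ! ℕ.* T ℕ.+ S) ℕ.* P)   ≡⟨ expand (suc d) T (d !) S P ⟩
    A ℕ.+ S ℕ.* P                                      ≤⟨ ℕP.+-monoʳ-≤ A (ℕP.*-monoʳ-≤ S (ℕP.m≤n*m P T)) ⟩
    A ℕ.+ S ℕ.* (T ℕ.* P)                              ≡⟨ collect (suc d) T (d !) S P ⟩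
    (suc d ! ℕ.* T ℕ.+ slack (suc d)) ℕ.* T ^ suc d    ∎
    where
    open ℕP.≤-Reasoning
    S = slack d
    P = T ^ d
    A = suc d ℕ.* d ! ℕ.* T ℕ.* T ℕ.* P ℕ.+ suc d ℕ.* S ℕ.* T ℕ.* P ℕ.+ d ! ℕ.* T ℕ.* P
    swap : ∀ a b c → a ℕ.* (b ℕ.* c) ≡ b ℕ.* (a ℕ.* c)
    swap = ℕRing.solve-∀
    expand : ∀ s t f k p → (1 ℕ.+ s ℕ.* t) ℕ.* ((f ℕ.* t ℕ.+ k) ℕ.* p)
           ≡ (s ℕ.* f ℕ.* t ℕ.* t ℕ.* p ℕ.+ s ℕ.* k ℕ.* t ℕ.* p ℕ.+ f ℕ.* t ℕ.* p) ℕ.+ k ℕ.* p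
    expand = ℕRing.solve-∀
    collect : ∀ s t f k p → (s ℕ.* f ℕ.* t ℕ.* t ℕ.* p ℕ.+ s ℕ.* k ℕ.* t ℕ.* p ℕ.+ f ℕ.* t ℕ.* p) ℕ.+ k ℕ.* (t ℕ.* p)
            ≡ (s ℕ.* f ℕ.* t ℕ.+ ((1 ℕ.+ s) ℕ.* k ℕ.+ f)) ℕ.* (t ℕ.* p)
    collect = ℕRing.solve-∀

  latticePoints-bounds : ∀ d → let N = length (elements (latticePoints (suc d))) in
                         d ! ℕ.* T ^ d ℕ.≤ N × T ℕ.* N ℕ.≤ (d ! ℕ.* T ℕ.+ slack d) ℕ.* T ^ d
  latticePoints-bounds d = subst (λ N → d ! ℕ.* T ^ d ℕ.≤ N × T ℕ.* N ℕ.≤ (d ! ℕ.* T ℕ.+ slack d) ℕ.* T ^ d)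
    (sym (length-map mirror (elements (admissible (suc d) ℤ.0ℤ))))
    (map₂ (λ N≤U → ℕP.≤-trans (ℕP.*-monoʳ-≤ T N≤U) (upperCount-bound d)) (admissible-length (suc d) ℤ.0ℤ))

  latticePointCount : ∀ n → LatticeCount (P132-312 n) T (length (elements (latticePoints n)))
  latticePointCount n = latticeCount {P = P132-312 n} (latticePoints n)

  latticeCount-bounds : ∀ d {N} → LatticeCount (P132-312 (suc d)) T N →
                        d ! ℕ.* T ^ d ℕ.≤ N × T ℕ.* N ℕ.≤ (d ! ℕ.* T ℕ.+ slack d) ℕ.* T ^ d
  latticeCount-bounds d N-count = subst (λ N → d ! ℕ.* T ^ d ℕ.≤ N × T ℕ.* N ℕ.≤ (d ! ℕ.* T ℕ.+ slack d) ℕ.* T ^ d)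
    (latticeCount-unique {P = P132-312 (suc d)} (latticePointCount (suc d)) N-count) (latticePoints-bounds d)

-- Asymptotics

archimedean : ∀ K ε → 0ℚ < ε → ∀ t → K ℕ.* ℚ.denominatorℕ ε ℕ.≤ t → fromℕ K < fromℕ (suc t) * ε
archimedean K ε 0<ε t K*den≤t = ℚP.*-cancelʳ-<-nonNeg (fromℕ den) {{ℚ.nonNegative (fromℕ-nonNeg den)}} (begin-strict
  fromℕ K * fromℕ den                  ≡⟨ fromℕ-* K den ⟨
  fromℕ (K ℕ.* den)                    <⟨ fromℤ-mono-< (ℤ.+<+ (s≤s K*den≤t)) ⟩
  fromℕ T                              ≡⟨ ℚP.*-identityʳ (fromℕ T) ⟨
  fromℕ T * 1ℚ                         ≤⟨ ℚP.*-monoˡ-≤-nonNeg (fromℕ T) {{ℚ.nonNegative (fromℕ-nonNeg T)}} 1≤num ⟩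
  fromℕ T * fromℤ (ℚ.numerator ε)      ≡⟨ cong (fromℕ T *_) den*ε≡num ⟨
  fromℕ T * (fromℕ den * ε)            ≡⟨ commute (fromℕ T) (fromℕ den) ε ⟩
  fromℕ T * ε * fromℕ den              ∎)
  where
  open ℚP.≤-Reasoning
  T = suc t
  den = ℚ.denominatorℕ ε
  den*ε≡num : fromℕ den * ε ≡ fromℤ (ℚ.numerator ε)
  den*ε≡num = trans (cong (fromℕ den *_) (sym (ℚP.↥p/↧p≡p ε))) (*-/-cancel den (ℚ.numerator ε))
  1≤num : 1ℚ ≤ fromℤ (ℚ.numerator ε)
  1≤num = fromℤ-mono-≤ (ℤP.i<j⇒suc[i]≤j (fromℤ-cancel-< (subst₂ _<_ (ℚP.*-zeroʳ (fromℕ den)) den*ε≡num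
            (ℚP.*-monoʳ-<-pos (fromℕ den) 0<ε))))
  commute : ∀ a b c → a * (b * c) ≡ a * c * b
  commute = solve-∀ ℚ-ring

ratio-bounds : ∀ {L K T P N} .{{_ : ℕ.NonZero P}} → L ℕ.* P ℕ.≤ N → T ℕ.* N ℕ.≤ (L ℕ.* T ℕ.+ K) ℕ.* P →
               fromℕ L ≤ ℤ.+ N / P × fromℕ T * (ℤ.+ N / P - fromℕ L) ≤ fromℕ K
ratio-bounds {L} {K} {T} {P} {N} LP≤N TN≤[LT+K]P = L≤Y , T[Y-L]≤K
  where
  Y = ℤ.+ N / P
  P*Y≡N : fromℕ P * Y ≡ fromℕ N
  P*Y≡N = *-/-cancel P (ℤ.+ N)
  instance
    P-pos : ℚ.Positive (fromℕ P)
    P-pos = ℚ.positive (fromℤ-mono-< (ℤ.+<+ (ℕP.n≢0⇒n>0 (ℕ.≢-nonZero⁻¹ P))))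
  L≤Y : fromℕ L ≤ Y
  L≤Y = ℚP.*-cancelˡ-≤-pos (fromℕ P) (subst₂ _≤_ (trans (fromℕ-* L P) (ℚP.*-comm (fromℕ L) (fromℕ P)))
          (sym P*Y≡N) (fromℕ-mono-≤ LP≤N))
  commute : ∀ a b c → a * (b * c) ≡ b * (a * c)
  commute = solve-∀ ℚ-ring
  TY≤LT+K : fromℕ T * Y ≤ fromℕ L * fromℕ T + fromℕ K
  TY≤LT+K = ℚP.*-cancelˡ-≤-pos (fromℕ P) (subst₂ _≤_
    (trans (fromℕ-* T N) (trans (cong (fromℕ T *_) (sym P*Y≡N)) (commute (fromℕ T) (fromℕ P) Y)))
    (trans (fromℕ-* (L ℕ.* T ℕ.+ K) P)
           (trans (cong (_* fromℕ P) (trans (fromℕ-+ (L ℕ.* T) K) (cong (_+ fromℕ K) (fromℕ-* L T))))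
                  (ℚP.*-comm (fromℕ L * fromℕ T + fromℕ K) (fromℕ P))))
    (fromℕ-mono-≤ TN≤[LT+K]P))
  rearrange : ∀ t y l k → l * t + k - t * y ≡ k - t * (y - l)
  rearrange = solve-∀ ℚ-ring
  T[Y-L]≤K : fromℕ T * (Y - fromℕ L) ≤ fromℕ K
  T[Y-L]≤K = 0≤-⇒≤ (subst (0ℚ ≤_) (rearrange (fromℕ T) Y (fromℕ L) (fromℕ K)) (≤⇒0≤- TY≤LT+K))

convergence : ∀ (L K d : ℕ) ε → 0ℚ < ε → ∃[ t₀ ] ∀ t N → t₀ ℕ.≤ t →
  L ℕ.* suc t ^ d ℕ.≤ N → suc t ℕ.* N ℕ.≤ (L ℕ.* suc t ℕ.+ K) ℕ.* suc t ^ d →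
  ∣ (ℤ.+ N / suc t ^ d) {{ℕP.m^n≢0 (suc t) d}} - ℤ.+ L / 1 ∣ < ε
convergence L K d ε 0<ε = K ℕ.* ℚ.denominatorℕ ε , close
  where
  close : ∀ t N → K ℕ.* ℚ.denominatorℕ ε ℕ.≤ t → L ℕ.* suc t ^ d ℕ.≤ N →
          suc t ℕ.* N ℕ.≤ (L ℕ.* suc t ℕ.+ K) ℕ.* suc t ^ d →
          ∣ (ℤ.+ N / suc t ^ d) {{ℕP.m^n≢0 (suc t) d}} - ℤ.+ L / 1 ∣ < ε
  close t N t₀≤t lower upper = begin-strict
    ∣ Y - ℤ.+ L / 1 ∣  ≡⟨ cong (λ l → ∣ Y - l ∣) (/1≡fromℤ (ℤ.+ L)) ⟩
    ∣ Y - fromℕ L ∣    ≡⟨ ℚP.0≤p⇒∣p∣≡p (≤⇒0≤- L≤Y) ⟩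
    Y - fromℕ L        <⟨ ℚP.*-cancelˡ-<-nonNeg (fromℕ (suc t)) {{ℚ.nonNegative (fromℕ-nonNeg (suc t))}}
                            (ℚP.≤-<-trans T[Y-L]≤K (archimedean K ε 0<ε t t₀≤t)) ⟩
    ε                  ∎
    where
    open ℚP.≤-Reasoning
    instance
      P≢0 : ℕ.NonZero (suc t ^ d)
      P≢0 = ℕP.m^n≢0 (suc t) d
    Y = ℤ.+ N / suc t ^ d
    bounds = ratio-bounds {L} {K} {suc t} lower upper
    L≤Y = proj₁ bounds
    T[Y-L]≤K = proj₂ bounds

corollary3p5 : (n : ℕ) → 1 ℕ.≤ n → RelVolume (P132-312 n) (ℤ.+ ((n ∸ 1) !) / 1)
corollary3p5 (suc d) _ =
  d , P-affDim d , (λ t → _ , Dilated.latticePointCount (suc t) (suc d)) ,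
  λ ε 0<ε → map₂ (λ close t N t₀≤t N-count → uncurry (close t N t₀≤t) (Dilated.latticeCount-bounds (suc t) d N-count))
                 (convergence (d !) (slack d) d ε 0<ε)
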